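{- Let $G \in \mathfrak{T}$ have at least three triangles. Then $\mathcal{D}_{\mathrm{lir}}(G)$ is at least the number of pendant triangles of $G$ none of whose vertices has degree two in $G$.
   Context: The family $\mathfrak{T}$ is defined recursively: the cycle $C_3$ belongs to $\mathfrak{T}$; if $G \in \mathfrak{T}$, then any graph $G'$ obtained from $G$ by identifying a vertex $v \in V(G)$ of degree two lying on a $3$-cycle of $G$ either with an endvertex of a (new, disjoint) path of even length, or with an endvertex of a (new, disjoint) path of odd length whose other endvertex is identified with a vertex of a new (disjoint) $3$-cycle, belongs to $\mathfrak{T}$. For $G \in \mathfrak{T}$, let $G_\triangle$ be the tree whose vertices are the triangles of $G$, two being adjacent iff an odd-length path in $G$ connects the corresponding triangles; triangles of $G$ corresponding to leaves of $G_\triangle$ are called pendant triangles. A (multi)graph is locally irregular if the two endvertices of every edge have different degrees (counting parallel edges with multiplicity). For $E_d \subseteq E(G)$, $G + E_d$ is the multigraph obtained by replacing each edge of $E_d$ by two parallel edges. For a connected graph $G$ not isomorphic to $K_2$ or $K_3$, $\mathcal{D}_{\mathrm{lir}}(G)$ is the minimum size of a set $E_d \subseteq E(G)$ such that the edges of $G+E_d$ can be colored with at most two colors so that each color class induces a locally irregular submultigraph and parallel edges receive the same color. -}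

module Defs where

open import Data.Nat using (ℕ; zero; suc; _+_; _*_; _<_; _≤_)
open import Data.Fin using (Fin; toℕ; fromℕ; inject₁) renaming (_≟_ to _≟ᶠ_)
open import Data.Fin.Base using (zero; suc)
open import Data.List using (List; []; _∷_; _∷ʳ_; _++_; map; length; lookup; allFin)
open import Data.Nat.ListAction using (sum)
open import Data.List.Membership.Propositional using (_∈_)
open import Data.List.Relation.Unary.All using (All)
open import Data.List.Relation.Unary.Linked using (Linked)
open import Data.List.Relation.Unary.Unique.Propositional using (Unique)
open import Data.Bool using (Bool; true; false; if_then_else_; _∨_; _∧_) renaming (_≟_ to _≟ᵇ_)
open import Data.Product using (Σ; ∃; ∃-syntax; _×_; _,_; proj₁; proj₂)
open import Data.Sum using (_⊎_)
open import Relation.Nullary using (¬_; does)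
open import Relation.Binary.PropositionalEquality using (_≡_; _≢_)

-- Finite simple graphs: vertex set Fin n, edges given as a list of
-- pairs (each unordered edge listed once).  Graphs built below by the
-- 𝔗-construction are automatically simple (no loops, no repeated edges).

record Graph : Set where
  constructor mkGraph
  field
    n : ℕ
    E : List (Fin n × Fin n)
open Graph public

V : Graph → Set
V G = Fin (n G)

Adj : (G : Graph) → V G → V G → Set
Adj G a b = ((a , b) ∈ E G) ⊎ ((b , a) ∈ E G)

degL : ∀ {m} → Fin m → List (Fin m × Fin m) → ℕ
degL v [] = 0
degL v ((a , b) ∷ es) =
  (if does (a ≟ᶠ v) ∨ does (b ≟ᶠ v) then 1 else 0) + degL v es

deg : (G : Graph) → V G → ℕ
deg G v = degL v (E G)

OnTriangle : (G : Graph) → V G → Set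
OnTriangle G v = Σ (V G) λ a → Σ (V G) λ b → (Adj G v a × Adj G v b × Adj G a b)

liftE : ∀ {m} → Fin m × Fin m → Fin (suc m) × Fin (suc m)
liftE (a , b) = inject₁ a , inject₁ b

pendantVertex : (G : Graph) → V G → Σ Graph V
pendantVertex (mkGraph m es) u =
  mkGraph (suc m) (map liftE es ∷ʳ (inject₁ u , fromℕ m)) , fromℕ m

attachPath : (G : Graph) → V G → ℕ → Σ Graph V
attachPath G v zero = G , v
attachPath G v (suc L) with pendantVertex G v
... | H , w = attachPath H w L

attachTriangle : (G : Graph) → V G → Graph
attachTriangle (mkGraph m es) w =
  mkGraph (suc (suc m))
    (map (λ e → liftE (liftE e)) es ++
      ( (inject₁ (inject₁ w) , inject₁ (fromℕ m))
      ∷ (inject₁ (inject₁ w) , fromℕ (suc m))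
      ∷ (inject₁ (fromℕ m) , fromℕ (suc m)) ∷ []))

C3 : Graph
C3 = mkGraph 3 ((zero , suc zero) ∷ (suc zero , suc (suc zero)) ∷ (zero , suc (suc zero)) ∷ [])

data InT : Graph → Set where
  base : InT C3
  evenPath : ∀ {G} → InT G → (v : V G) → deg G v ≡ 2 → OnTriangle G v →
             (k : ℕ) → InT (proj₁ (attachPath G v (2 * k)))
  oddPathTriangle : ∀ {G} → InT G → (v : V G) → deg G v ≡ 2 → OnTriangle G v →
             (k : ℕ) → let P = attachPath G v (suc (2 * k)) in
             InT (attachTriangle (proj₁ P) (proj₂ P))

-- a triangle, as the (canonically ordered) triple of its vertices
Tri : Graph → Set
Tri G = V G × V G × V G

IsTriangle : (G : Graph) → Tri G → Set
IsTriangle G (a , b , c) =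
  (toℕ a < toℕ b) × (toℕ b < toℕ c) × Adj G a b × Adj G b c × Adj G a c

InTri : (G : Graph) → V G → Tri G → Set
InTri G x (a , b , c) = (x ≡ a) ⊎ (x ≡ b) ⊎ (x ≡ c)

OnSomeTriangle : (G : Graph) → V G → Set
OnSomeTriangle G x = Σ (Tri G) (λ T → IsTriangle G T × InTri G x T)

IsPath : (G : Graph) → List (V G) → Set
IsPath G vs = Unique vs × Linked (Adj G) vs

-- T₁ and T₂ are adjacent in G_△: an odd-length path of G connects them
-- (its endvertices lie on T₁ resp. T₂ and its inner vertices lie on no
-- triangle, i.e. it is one of the connecting paths of the construction)
TriAdj : (G : Graph) → Tri G → Tri G → Set
TriAdj G T₁ T₂ =
  T₁ ≢ T₂ ×
  Σ (V G) λ x → Σ (List (V G)) λ mid → Σ (V G) λ y →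
    ( InTri G x T₁ × InTri G y T₂
    × IsPath G (x ∷ mid ++ (y ∷ []))
    × All (λ m → ¬ OnSomeTriangle G m) mid
    × ∃[ k ] (length mid ≡ 2 * k))   -- path length = length mid + 1 is odd

Pendant : (G : Graph) → Tri G → Set
Pendant G T = Σ (Tri G) λ T' → (IsTriangle G T' × TriAdj G T T' ×
  (∀ T'' → IsTriangle G T'' → TriAdj G T T'' → T'' ≡ T'))

NoDeg2Vertex : (G : Graph) → Tri G → Set
NoDeg2Vertex G (a , b , c) = (deg G a ≢ 2) × (deg G b ≢ 2) × (deg G c ≢ 2)

EdgeIx : Graph → Set
EdgeIx G = Fin (length (E G))

countTrue : ∀ {m} → (Fin m → Bool) → ℕ
countTrue {m} f = sum (map (λ i → if f i then 1 else 0) (allFin m))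

-- degree of v in the colour class c of G + E_d (doubled edges count twice)
colDeg : (G : Graph) → (Ed col : EdgeIx G → Bool) → Bool → V G → ℕ
colDeg G Ed col c v = sum (map contrib (allFin (length (E G))))
  where
  contrib : EdgeIx G → ℕ
  contrib i with lookup (E G) i
  ... | (a , b) =
    if (does (col i ≟ᵇ c)) ∧ (does (a ≟ᶠ v) ∨ does (b ≟ᶠ v))
    then (if Ed i then 2 else 1) else 0

-- col assigns one colour to each edge of G (hence the same colour to both
-- parallel copies of a doubled edge); each colour class is locally irregular
LIColouring : (G : Graph) → (Ed col : EdgeIx G → Bool) → Set
LIColouring G Ed col = ∀ (i : EdgeIx G) → Endpoints (col i) (lookup (E G) i)
  where
  Endpoints : Bool → V G × V G → Set
  Endpoints c (a , b) = colDeg G Ed col c a ≢ colDeg G Ed col c b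

-- E_d (as a subset of E(G)) admits a locally irregular 2-colouring of G + E_d
Admissible : (G : Graph) → (EdgeIx G → Bool) → Set
Admissible G Ed = Σ (EdgeIx G → Bool) λ col → LIColouring G Ed col

-- Every graph of 𝔗 carries a labelling telling, for each vertex, whether it lies on a triangle (with
-- the depth of that triangle in G_△ and what the construction attached at it), on an even pendant
-- path, or inside an odd path joining two triangles; each construction step preserves it, and it
-- determines every neighbourhood. Let T be a pendant triangle with no vertex of degree two. Every
-- vertex of T carries a branch, and as T is a leaf of G_△ at most one branch is odd, so two vertices
-- B, C of T carry even pendant paths. If no edge of these paths is doubled, local irregularity forces
-- the colour degrees 1, 2, 1, 2, ... from their free ends, so B and C have colour degree other than
-- 2 in the colours of their branch edges; if no edge of T is doubled either, the colouring around T
-- is forced, and the branch edge at the third vertex A must be doubled with all edges at A of one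
-- colour. So T owns a doubled edge (an edge of T, an edge of a pendant path at T, or such a branch
-- edge at A), and different pendant triangles own different edges.

module Submission where

open import Defs
open import Data.Nat using (ℕ; zero; suc; _+_; _*_; _<_; _≤_; z≤n; s≤s)
open import Data.Nat.Properties hiding (_≟_)
import Data.Nat.Properties as ℕ
open import Algebra.Properties.CommutativeSemigroup +-commutativeSemigroup using (x∙yz≈y∙xz)
open import Data.Fin using (Fin; zero; suc; _≟_; toℕ; inject₁; fromℕ)
open import Data.Fin.Properties using (toℕ-injective; toℕ-inject₁; toℕ-fromℕ; inject₁-injective; fromℕ≢inject₁; toℕ<n)
open import Data.List using (List; []; _∷_; map; length; allFin; lookup; _++_)
open import Data.List.Properties using (map-tabulate)
open import Data.Nat.ListAction using (sum)
open import Data.List.Relation.Unary.All using (All; []; _∷_)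
import Data.List.Relation.Unary.All as All
open import Data.List.Relation.Unary.All.Properties using (¬Any⇒All¬; All¬⇒¬Any; ++⁺; map⁺)
open import Data.List.Relation.Unary.Any using (here; there; index)
open import Data.List.Relation.Unary.Any.Properties using (lookup-index)
open import Data.List.Membership.Propositional using (_∈_; _∉_)
open import Data.List.Membership.Propositional.Properties using (∈-lookup; ∈-++⁺ˡ; ∈-++⁺ʳ; ∈-map⁺)
import Data.List.Membership.DecPropositional as DecMembership
open import Data.List.Relation.Unary.Unique.Propositional using (Unique)
open import Data.List.Relation.Unary.AllPairs using ([]; _∷_)
open import Data.List.Relation.Unary.Linked using (Linked; [-]; _∷_)
open import Data.Bool using (Bool; true; false; if_then_else_; _∨_; _∧_) renaming (_≟_ to _≟ᵇ_)
open import Data.Product using (Σ; _×_; _,_; proj₁; proj₂)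
open import Data.Sum using (_⊎_; inj₁; inj₂)
open import Data.Empty using (⊥; ⊥-elim)
open import Data.Unit using (⊤; tt)
open import Relation.Nullary using (Dec; does; yes; no; ¬_)
open import Relation.Nullary.Decidable using (dec-true; dec-false; _→-dec_; _×-dec_; ¬?; toWitness)
open import Relation.Binary.PropositionalEquality
open import Relation.Binary.Definitions using (tri<; tri≈; tri>)
open import Function using (_∘_)

sumFin : ∀ {m} → (Fin m → ℕ) → ℕ
sumFin {m} g = sum (map g (allFin m))

sumFin-suc : ∀ {m} (g : Fin (suc m) → ℕ) → sumFin g ≡ g zero + sumFin (g ∘ suc)
sumFin-suc {m} g = cong (λ xs → g zero + sum xs)
  (trans (map-tabulate suc g) (sym (map-tabulate (λ i → i) (g ∘ suc))))

sumFin-zero : ∀ {m} (g : Fin m → ℕ) → (∀ i → g i ≡ 0) → sumFin g ≡ 0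
sumFin-zero {zero} g e = refl
sumFin-zero {suc m} g e = trans (sumFin-suc g) (cong₂ _+_ (e zero) (sumFin-zero (g ∘ suc) (e ∘ suc)))

zeroAt : ∀ {m} → Fin m → (Fin m → ℕ) → Fin m → ℕ
zeroAt i g j = if does (j ≟ i) then 0 else g j

zeroAt-≢ : ∀ {m} (g : Fin m → ℕ) {i j : Fin m} → j ≢ i → zeroAt i g j ≡ g j
zeroAt-≢ g {i} {j} j≢i rewrite dec-false (j ≟ i) j≢i = refl

sumFin-split : ∀ {m} (g : Fin m → ℕ) (i : Fin m) → sumFin g ≡ g i + sumFin (zeroAt i g)
sumFin-split {suc m} g zero = trans (sumFin-suc g) (cong (g zero +_) (sym (sumFin-suc (zeroAt zero g))))
sumFin-split {suc m} g (suc i) = begin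
  sumFin g                                         ≡⟨ sumFin-suc g ⟩
  g zero + sumFin (g ∘ suc)                        ≡⟨ cong (g zero +_) (sumFin-split (g ∘ suc) i) ⟩
  g zero + (g (suc i) + sumFin (zeroAt i (g ∘ suc))) ≡⟨ x∙yz≈y∙xz (g zero) (g (suc i)) _ ⟩
  g (suc i) + (g zero + sumFin (zeroAt i (g ∘ suc))) ≡⟨ cong (g (suc i) +_) (sym (sumFin-suc (zeroAt (suc i) g))) ⟩
  g (suc i) + sumFin (zeroAt (suc i) g)            ∎
  where open ≡-Reasoning

sumList : ∀ {m} → (Fin m → ℕ) → List (Fin m) → ℕ
sumList g [] = 0
sumList g (i ∷ is) = g i + sumList g is

sumFin-support : ∀ {m} (g : Fin m → ℕ) (is : List (Fin m)) → Unique is →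
  (∀ j → j ∉ is → g j ≡ 0) → sumFin g ≡ sumList g is
sumFin-support g [] _ outside = sumFin-zero g (λ j → outside j (λ ()))
sumFin-support g (i ∷ is) (i∉is ∷ u) outside =
  trans (sumFin-split g i) (cong (g i +_) (trans (sumFin-support (zeroAt i g) is u outside′) (erase-off is i∉is)))
  where
  outside′ : ∀ j → j ∉ is → zeroAt i g j ≡ 0
  outside′ j j∉is with j ≟ i
  ... | yes _ = refl
  ... | no j≢i = outside j (All¬⇒¬Any (j≢i ∷ ¬Any⇒All¬ is j∉is))
  erase-off : ∀ ks → All (i ≢_) ks → sumList (zeroAt i g) ks ≡ sumList g ks
  erase-off [] _ = refl
  erase-off (k ∷ ks) (i≢k ∷ rest) = cong₂ _+_ (zeroAt-≢ g (i≢k ∘ sym)) (erase-off ks rest)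

indicator : Bool → ℕ
indicator b = if b then 1 else 0

length≤countTrue : ∀ {m} (f : Fin m → Bool) (is : List (Fin m)) → Unique is →
  All (λ i → f i ≡ true) is → length is ≤ countTrue f
length≤countTrue {m} f is u fs = go is u (indicator ∘ f) (All.map (λ fi → ≤-reflexive (sym (cong indicator fi))) fs)
  where
  go : ∀ is → Unique is → (g : Fin m → ℕ) → All (λ i → 1 ≤ g i) is → length is ≤ sumFin g
  go [] _ _ _ = z≤n
  go (i ∷ is) (i∉is ∷ u) g (gi ∷ gs) =
    subst (suc (length is) ≤_) (sym (sumFin-split g i)) (+-mono-≤ gi (go is u (zeroAt i g) (keep is i∉is gs)))
    where
    keep : ∀ ks → All (i ≢_) ks → All (λ k → 1 ≤ g k) ks → All (λ k → 1 ≤ zeroAt i g k) ks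
    keep [] _ _ = []
    keep (k ∷ ks) (i≢k ∷ ns) (p ∷ ps) = subst (1 ≤_) (sym (zeroAt-≢ g (i≢k ∘ sym))) p ∷ keep ks ns ps

incidentTo : ∀ {m} → Fin m → Fin m × Fin m → Bool
incidentTo v (a , b) = does (a ≟ v) ∨ does (b ≟ v)

degL≡countTrue : ∀ {m} (v : Fin m) (es : List (Fin m × Fin m)) →
  degL v es ≡ countTrue (λ i → incidentTo v (lookup es i))
degL≡countTrue v [] = refl
degL≡countTrue v ((a , b) ∷ es) = trans (cong (_ +_) (degL≡countTrue v es))
  (sym (sumFin-suc (λ i → indicator (incidentTo v (lookup ((a , b) ∷ es) i)))))

adj-sym : ∀ {G x y} → Adj G x y → Adj G y x
adj-sym (inj₁ p) = inj₂ p
adj-sym (inj₂ p) = inj₁ p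

module _ (G : Graph) where

  Joins : EdgeIx G → V G → V G → Set
  Joins e x w = (lookup (E G) e ≡ (x , w)) ⊎ (lookup (E G) e ≡ (w , x))

  Incident : V G → EdgeIx G → Bool
  Incident x e = incidentTo x (lookup (E G) e)

  Loopless : Set
  Loopless = ∀ x → ¬ Adj G x x

  adj⇒edge : ∀ {x w} → Adj G x w → Σ (EdgeIx G) λ e → Joins e x w
  adj⇒edge (inj₁ p) = index p , inj₁ (sym (lookup-index p))
  adj⇒edge (inj₂ p) = index p , inj₂ (sym (lookup-index p))

  joins⇒adj : ∀ {e x w} → Joins e x w → Adj G x w
  joins⇒adj {e} (inj₁ p) = inj₁ (subst (_∈ E G) p (∈-lookup e))
  joins⇒adj {e} (inj₂ p) = inj₂ (subst (_∈ E G) p (∈-lookup e))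

  joins⇒incident : ∀ {e x w} → Joins e x w → Incident x e ≡ true
  joins⇒incident {x = x} (inj₁ p) rewrite p | dec-true (x ≟ x) refl = refl
  joins⇒incident {x = x} {w} (inj₂ p) rewrite p | dec-true (x ≟ x) refl with does (w ≟ x)
  ... | true = refl
  ... | false = refl

  edgeOf : ∀ {x w} → Adj G x w → EdgeIx G
  edgeOf a = proj₁ (adj⇒edge a)

  edgeOf-joins : ∀ {x w} (a : Adj G x w) → Joins (edgeOf a) x w
  edgeOf-joins a = proj₂ (adj⇒edge a)

  joins-sym : ∀ {e x w} → Joins e x w → Joins e w x
  joins-sym (inj₁ p) = inj₂ p
  joins-sym (inj₂ p) = inj₁ p

  joins-same : ∀ {f a b c d} → Joins f a b → Joins f c d → ((a ≡ c) × (b ≡ d)) ⊎ ((a ≡ d) × (b ≡ c))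
  joins-same (inj₁ p) (inj₁ q) with trans (sym p) q
  ... | refl = inj₁ (refl , refl)
  joins-same (inj₁ p) (inj₂ q) with trans (sym p) q
  ... | refl = inj₂ (refl , refl)
  joins-same (inj₂ p) (inj₁ q) with trans (sym p) q
  ... | refl = inj₂ (refl , refl)
  joins-same (inj₂ p) (inj₂ q) with trans (sym p) q
  ... | refl = inj₁ (refl , refl)

  deg≡countIncident : ∀ x → deg G x ≡ countTrue (Incident x)
  deg≡countIncident x = degL≡countTrue x (E G)

  module _ (loopless : Loopless) where

    joins-unique : ∀ {e x w w′} → Joins e x w → Joins e x w′ → w ≡ w′
    joins-unique (inj₁ p) (inj₁ q) = cong proj₂ (trans (sym p) q)
    joins-unique {e} {x} (inj₁ p) (inj₂ q) =
      ⊥-elim (loopless x (joins⇒adj {e} (inj₁ (trans p (cong (x ,_) (sym (cong proj₂ (trans (sym q) p))))))))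
    joins-unique {e} {x} (inj₂ p) (inj₁ q) =
      ⊥-elim (loopless x (joins⇒adj {e} (inj₁ (trans q (cong (x ,_) (sym (cong proj₂ (trans (sym p) q))))))))
    joins-unique (inj₂ p) (inj₂ q) = cong proj₁ (trans (sym p) q)

    edgesTo : ∀ {x ws} → All (Adj G x) ws → List (EdgeIx G)
    edgesTo [] = []
    edgesTo (p ∷ ps) = proj₁ (adj⇒edge p) ∷ edgesTo ps

    edgesTo-incident : ∀ {x ws} (ps : All (Adj G x) ws) → All (λ e → Incident x e ≡ true) (edgesTo ps)
    edgesTo-incident [] = []
    edgesTo-incident (p ∷ ps) = joins⇒incident {proj₁ (adj⇒edge p)} (proj₂ (adj⇒edge p)) ∷ edgesTo-incident ps

    edgesTo-unique : ∀ {x ws} (ps : All (Adj G x) ws) → Unique ws → Unique (edgesTo ps)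
    edgesTo-unique [] _ = []
    edgesTo-unique {x} (p ∷ ps) (w∉ws ∷ u) = fresh ps w∉ws ∷ edgesTo-unique ps u
      where
      fresh : ∀ {ws′} (qs : All (Adj G x) ws′) → All (_ ≢_) ws′ → All (proj₁ (adj⇒edge p) ≢_) (edgesTo qs)
      fresh [] [] = []
      fresh (q ∷ qs) (w≢ ∷ w≢s) = (λ eq → w≢ (joins-unique (proj₂ (adj⇒edge p))
        (subst (λ e → Joins e x _) (sym eq) (proj₂ (adj⇒edge q))))) ∷ fresh qs w≢s

    length-edgesTo : ∀ {x ws} (ps : All (Adj G x) ws) → length (edgesTo ps) ≡ length ws
    length-edgesTo [] = refl
    length-edgesTo (p ∷ ps) = cong suc (length-edgesTo ps)

    module _ {x ws} (u : Unique ws) (ps : All (Adj G x) ws) (len : length ws ≡ deg G x) where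

      private
        too-many : ∀ {es} → Unique es → All (λ e → Incident x e ≡ true) es → length es ≡ suc (length ws) → ⊥
        too-many ues ies len′ = <-irrefl refl (≤-trans (≤-reflexive (sym len′))
          (≤-trans (length≤countTrue (Incident x) _ ues ies)
            (≤-reflexive (trans (sym (deg≡countIncident x)) (sym len)))))

      neighbour-complete : ∀ {w} → Adj G x w → w ∈ ws
      neighbour-complete {w} a with DecMembership._∈?_ _≟_ w ws
      ... | yes w∈ws = w∈ws
      ... | no w∉ws = ⊥-elim (too-many (edgesTo-unique (a ∷ ps) (¬Any⇒All¬ ws w∉ws ∷ u))
                        (edgesTo-incident (a ∷ ps)) (cong suc (length-edgesTo ps)))

      incident-complete : ∀ e → Incident x e ≡ true → e ∈ edgesTo ps
      incident-complete e inc with DecMembership._∈?_ _≟_ e (edgesTo ps)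
      ... | yes e∈ = e∈
      ... | no e∉ = ⊥-elim (too-many (¬Any⇒All¬ _ e∉ ∷ edgesTo-unique ps u)
                      (inc ∷ edgesTo-incident ps) (cong suc (length-edgesTo ps)))

      private
        edgesTo-joins : ∀ {ws′} (qs : All (Adj G x) ws′) {e} → e ∈ edgesTo qs → Σ (V G) λ w → (w ∈ ws′) × Joins e x w
        edgesTo-joins (q ∷ qs) (here refl) = _ , here refl , proj₂ (adj⇒edge q)
        edgesTo-joins (q ∷ qs) (there e∈) with edgesTo-joins qs e∈
        ... | w , w∈ , j = w , there w∈ , j

        edgesTo-injective : ∀ {ws′} (qs : All (Adj G x) ws′) → Unique ws′ → ∀ {e e′ w} → e ∈ edgesTo qs → e′ ∈ edgesTo qs →
          Joins e x w → Joins e′ x w → e ≡ e′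
        edgesTo-injective (q ∷ qs) u (here refl) (here refl) _ _ = refl
        edgesTo-injective (q ∷ qs) (w∉ ∷ u) (here refl) (there e′∈) j j′ with edgesTo-joins qs e′∈
        ... | w₁ , w₁∈ , j₁ = ⊥-elim (All¬⇒¬Any w∉
          (subst (_∈ _) (sym (trans (joins-unique (proj₂ (adj⇒edge q)) j) (joins-unique j′ j₁))) w₁∈))
        edgesTo-injective (q ∷ qs) (w∉ ∷ u) (there e∈) (here refl) j j′ with edgesTo-joins qs e∈
        ... | w₁ , w₁∈ , j₁ = ⊥-elim (All¬⇒¬Any w∉
          (subst (_∈ _) (sym (trans (joins-unique (proj₂ (adj⇒edge q)) j′) (joins-unique j j₁))) w₁∈))
        edgesTo-injective (q ∷ qs) (_ ∷ u) (there e∈) (there e′∈) j j′ = edgesTo-injective qs u e∈ e′∈ j j′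

      neighbours⇒edge-unique : ∀ {e e′ w} → Joins e x w → Joins e′ x w → e ≡ e′
      neighbours⇒edge-unique {e} {e′} j j′ = edgesTo-injective ps u
        (incident-complete e (joins⇒incident j)) (incident-complete e′ (joins⇒incident j′)) j j′

module _ (G : Graph) (Ed col : EdgeIx G → Bool) where

  weight : EdgeIx G → Bool → ℕ
  weight e c = if does (col e ≟ᵇ c) then (if Ed e then 2 else 1) else 0

  weight-undoubled : ∀ e c → Ed e ≡ false → weight e c ≡ (if does (col e ≟ᵇ c) then 1 else 0)
  weight-undoubled e c undoubled rewrite undoubled with does (col e ≟ᵇ c)
  ... | true = refl
  ... | false = refl

  LIColouring⇒irregular : LIColouring G Ed col → ∀ {e x w} → Joins G e x w → colDeg G Ed col (col e) x ≢ colDeg G Ed col (col e) w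
  LIColouring⇒irregular LI {e} (inj₁ p) h = LI e (subst (λ q → colDeg G Ed col (col e) (proj₁ q) ≡ colDeg G Ed col (col e) (proj₂ q)) (sym p) h)
  LIColouring⇒irregular LI {e} (inj₂ p) h = LI e (subst (λ q → colDeg G Ed col (col e) (proj₁ q) ≡ colDeg G Ed col (col e) (proj₂ q)) (sym p) (sym h))

  weightSum : List (EdgeIx G) → Bool → ℕ
  weightSum [] c = 0
  weightSum (e ∷ es) c = weight e c + weightSum es c

  colDeg≡weightSum : (loopless : Loopless G) → ∀ {x ws} → Unique ws → (ps : All (Adj G x) ws) →
    length ws ≡ deg G x → ∀ c → colDeg G Ed col c x ≡ weightSum (edgesTo G loopless ps) c
  colDeg≡weightSum loopless {x} u ps len c =
    trans (sumFin-support contribution (edgesTo G loopless ps) (edgesTo-unique G loopless ps u) outside)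
      (onIncident (edgesTo G loopless ps) (edgesTo-incident G loopless ps))
    where
    contribution : EdgeIx G → ℕ
    contribution e = if does (col e ≟ᵇ c) ∧ Incident G x e then (if Ed e then 2 else 1) else 0
    outside : ∀ e → e ∉ edgesTo G loopless ps → contribution e ≡ 0
    outside e e∉ with Incident G x e in inc
    ... | true = ⊥-elim (e∉ (incident-complete G loopless u ps len e inc))
    ... | false with does (col e ≟ᵇ c)
    ...   | true = refl
    ...   | false = refl
    onIncident : ∀ es → All (λ e → Incident G x e ≡ true) es → sumList contribution es ≡ weightSum es c
    onIncident [] _ = refl
    onIncident (e ∷ es) (inc ∷ incs) = cong₂ _+_ (on e inc) (onIncident es incs)
      where
      on : ∀ e → Incident G x e ≡ true → contribution e ≡ weight e c
      on e inc rewrite inc with does (col e ≟ᵇ c)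
      ... | true = refl
      ... | false = refl

module _ {G : Graph} where

  <⇒≢ᶠ : ∀ {a b : V G} → toℕ a < toℕ b → a ≢ b
  <⇒≢ᶠ lt refl = <-irrefl refl lt

  min≤ : ∀ {T w} → IsTriangle G T → InTri G w T → toℕ (proj₁ T) ≤ toℕ w
  min≤ (ab , bc , _) (inj₁ refl) = ≤-refl
  min≤ (ab , bc , _) (inj₂ (inj₁ refl)) = <⇒≤ ab
  min≤ (ab , bc , _) (inj₂ (inj₂ refl)) = <⇒≤ (<-trans ab bc)

  ≤max : ∀ {T w} → IsTriangle G T → InTri G w T → toℕ w ≤ toℕ (proj₂ (proj₂ T))
  ≤max (ab , bc , _) (inj₁ refl) = <⇒≤ (<-trans ab bc)
  ≤max (ab , bc , _) (inj₂ (inj₁ refl)) = <⇒≤ bc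
  ≤max (ab , bc , _) (inj₂ (inj₂ refl)) = ≤-refl

  triangle-ext : ∀ {T T′} → IsTriangle G T → IsTriangle G T′ → (∀ {w} → InTri G w T → InTri G w T′) →
    (∀ {w} → InTri G w T′ → InTri G w T) → T ≡ T′
  triangle-ext {a , b , c} {a′ , b′ , c′} t@(ab , bc , _) t′ f g
    with toℕ-injective {i = a} {j = a′} (≤-antisym (min≤ t (g (inj₁ refl))) (min≤ t′ (f (inj₁ refl))))
       | toℕ-injective {i = c} {j = c′} (≤-antisym (≤max t′ (f (inj₂ (inj₂ refl)))) (≤max t (g (inj₂ (inj₂ refl)))))
  ... | refl | refl with f (inj₂ (inj₁ refl))
  ...   | inj₁ refl = ⊥-elim (<-irrefl refl ab)
  ...   | inj₂ (inj₁ refl) = refl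
  ...   | inj₂ (inj₂ refl) = ⊥-elim (<-irrefl refl bc)

  sortTriangle : Loopless G → ∀ {p q r} → q ≢ r → Adj G p q → Adj G q r → Adj G p r →
    Σ (Tri G) λ T → IsTriangle G T × InTri G p T × InTri G q T × InTri G r T
  sortTriangle nl {p} {q} {r} q≢r apq aqr apr with <-cmp (toℕ p) (toℕ q) | <-cmp (toℕ q) (toℕ r) | <-cmp (toℕ p) (toℕ r)
  ... | tri≈ _ e _ | _ | _ = ⊥-elim (nl p (subst (Adj G p) (sym (toℕ-injective e)) apq))
  ... | _ | tri≈ _ e _ | _ = ⊥-elim (q≢r (toℕ-injective e))
  ... | _ | _ | tri≈ _ e _ = ⊥-elim (nl p (subst (Adj G p) (sym (toℕ-injective e)) apr))
  ... | tri< pq _ _ | tri< qr _ _ | _ = (p , q , r) , (pq , qr , apq , aqr , apr) , inj₁ refl , inj₂ (inj₁ refl) , inj₂ (inj₂ refl)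
  ... | tri< pq _ _ | tri> _ _ rq | tri< pr _ _ = (p , r , q) , (pr , rq , apr , adj-sym aqr , apq) , inj₁ refl , inj₂ (inj₂ refl) , inj₂ (inj₁ refl)
  ... | tri< pq _ _ | tri> _ _ rq | tri> _ _ rp = (r , p , q) , (rp , pq , adj-sym apr , apq , adj-sym aqr) , inj₂ (inj₁ refl) , inj₂ (inj₂ refl) , inj₁ refl
  ... | tri> _ _ qp | tri< qr _ _ | tri< pr _ _ = (q , p , r) , (qp , pr , adj-sym apq , apr , aqr) , inj₂ (inj₁ refl) , inj₁ refl , inj₂ (inj₂ refl)
  ... | tri> _ _ qp | tri< qr _ _ | tri> _ _ rp = (q , r , p) , (qr , rp , aqr , adj-sym apr , adj-sym apq) , inj₂ (inj₂ refl) , inj₁ refl , inj₂ (inj₁ refl)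
  ... | tri> _ _ qp | tri> _ _ rq | _ = (r , q , p) , (rq , qp , adj-sym aqr , adj-sym apq , adj-sym apr) , inj₂ (inj₂ refl) , inj₂ (inj₁ refl) , inj₁ refl

  record OtherTwo (T : Tri G) (x : V G) : Set where
    field
      u v : V G
      u≢v : u ≢ v
      adj-u : Adj G x u
      adj-v : Adj G x v
      adj-uv : Adj G u v
      u∈T : InTri G u T
      v∈T : InTri G v T
      only : ∀ {w} → InTri G w T → (w ≡ x) ⊎ (w ≡ u) ⊎ (w ≡ v)

  otherTwo : ∀ {T x} → IsTriangle G T → InTri G x T → OtherTwo T x
  otherTwo {a , b , c} (ab , bc , aab , abc , aac) (inj₁ refl) = record
    { u = b ; v = c ; u≢v = <⇒≢ᶠ bc ; adj-u = aab ; adj-v = aac ; adj-uv = abc ; u∈T = inj₂ (inj₁ refl) ; v∈T = inj₂ (inj₂ refl)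
    ; only = λ w → w }
  otherTwo {a , b , c} (ab , bc , aab , abc , aac) (inj₂ (inj₁ refl)) = record
    { u = a ; v = c ; u≢v = <⇒≢ᶠ (<-trans ab bc) ; adj-u = adj-sym aab ; adj-v = abc ; adj-uv = aac ; u∈T = inj₁ refl ; v∈T = inj₂ (inj₂ refl)
    ; only = λ { (inj₁ q) → inj₂ (inj₁ q) ; (inj₂ (inj₁ q)) → inj₁ q ; (inj₂ (inj₂ q)) → inj₂ (inj₂ q) } }
  otherTwo {a , b , c} (ab , bc , aab , abc , aac) (inj₂ (inj₂ refl)) = record
    { u = a ; v = b ; u≢v = <⇒≢ᶠ ab ; adj-u = adj-sym aac ; adj-v = adj-sym abc ; adj-uv = aab ; u∈T = inj₁ refl ; v∈T = inj₂ (inj₁ refl)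
    ; only = λ { (inj₁ q) → inj₂ (inj₁ q) ; (inj₂ (inj₁ q)) → inj₂ (inj₂ q) ; (inj₂ (inj₂ q)) → inj₁ q } }

-- Labels

Odd Even : ℕ → Set
Odd zero = ⊥
Odd (suc n) = Even n
Even zero = ⊤
Even (suc n) = Odd n

2*suc : ∀ k → 2 * suc k ≡ suc (suc (2 * k))
2*suc k = cong suc (+-suc k (k + 0))

even-2* : ∀ k → Even (2 * k)
even-2* zero = tt
even-2* (suc k) = subst Even (sym (2*suc k)) (even-2* k)

evenHalf : ∀ n → Even n → Σ ℕ λ k → n ≡ 2 * k
evenHalf zero _ = 0 , refl
evenHalf (suc zero) ()
evenHalf (suc (suc n)) e with evenHalf n e
... | k , refl = suc k , sym (2*suc k)

oddHalf : ∀ m → Odd m → Σ ℕ λ k → suc m ≡ 2 * k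
oddHalf m o = evenHalf (suc m) o

data Branch : Set where
  none pendant down : Branch
  up : ℕ → Branch

data Label : Set where
  tri : ℕ → Branch → Label
  pend : ℕ → ℕ → Label
  link : ℕ → ℕ → ℕ → ℕ → Label

-- tri d b: a vertex of a triangle at depth d of G_△ (rooted at the initial C₃), where the
-- construction attached nothing (none), an even pendant path (pendant), the odd path down to a
-- child triangle (down), or the odd path up to the parent triangle, which leaves it at vertex o (up o).
-- pend o j: a vertex at distance j from the free end of the even pendant path attached at vertex o.
-- link o d m r: an inner vertex of the odd path from vertex o of a depth-d triangle down to a child
-- triangle, with m inner vertices below it and r above it.
-- Vertices are referred to by toℕ, which is stable under the embeddings of the construction.

IsUp : Branch → Set
IsUp (up _) = ⊤
IsUp _ = ⊥

depth pendOwner pendPos linkBelow linkAbove : Label → ℕ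
depth (tri d _) = d
depth _ = 0
pendOwner (pend o _) = o
pendOwner _ = 0
pendPos (pend _ j) = j
pendPos _ = 0
linkBelow (link _ _ m _) = m
linkBelow _ = 0
linkAbove (link _ _ _ r) = r
linkAbove _ = 0

n≢1+n : ∀ n → n ≢ suc n
n≢1+n n = m≢1+n+m n {0}

n≢2+n : ∀ n → n ≢ suc (suc n)
n≢2+n n = m≢1+n+m n {1}

n≢3+n : ∀ n → n ≢ suc (suc (suc n))
n≢3+n n = m≢1+n+m n {2}

module Invariant (G : Graph) (ℓ : ℕ → Label) where

  L : V G → Label
  L x = ℓ (toℕ x)

  -- the label of a vertex y of the triangle of a vertex labelled tri d br
  Mate : ℕ → Branch → V G → Set
  Mate d br y = Σ Branch λ br′ → (L y ≡ tri d br′) × (IsUp br → ¬ IsUp br′)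

  -- p is the neighbour of x, labelled tri d br, through which x's branch leaves the triangle
  BranchStart : ℕ → Branch → V G → V G → Set
  BranchStart d none x p = ⊥
  BranchStart d pendant x p = Σ ℕ λ j → (L p ≡ pend (toℕ x) j) × Odd j
  BranchStart d down x p = (Σ ℕ λ m → (L p ≡ link (toℕ x) d m 0) × Odd m) ⊎ (L p ≡ tri (suc d) (up (toℕ x)))
  BranchStart d (up o) x p = Σ ℕ λ d′ → (d ≡ suc d′) ×
     ((Σ ℕ λ r → (L p ≡ link o d′ 0 r) × Odd r) ⊎ ((L p ≡ tri d′ down) × (toℕ p ≡ o)))

  BranchCond : V G → ℕ → Branch → Set
  BranchCond x d none = deg G x ≡ 2
  BranchCond x d br = (deg G x ≡ 3) × Σ (V G) λ p → Adj G x p × BranchStart d br x p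

  TriCond : V G → ℕ → Branch → Set
  TriCond x d br = Σ (V G) λ y → Σ (V G) λ z → (y ≢ z) × Adj G x y × Adj G x z × Adj G y z ×
     Mate d br y × Mate d br z × BranchCond x d br

  PendUp : ℕ → ℕ → V G → Set
  PendUp o j w = (L w ≡ pend o (suc (suc j))) ⊎ (Σ ℕ λ d → (L w ≡ tri d pendant) × (toℕ w ≡ o))

  PendCond : V G → ℕ → ℕ → Set
  PendCond x o zero = (deg G x ≡ 1) × Σ (V G) λ w → Adj G x w × (L w ≡ pend o 1)
  PendCond x o (suc j) = (deg G x ≡ 2) × (Σ (V G) λ w → Adj G x w × (L w ≡ pend o j)) ×
     (Σ (V G) λ w → Adj G x w × PendUp o j w)

  LinkDown : ℕ → ℕ → ℕ → ℕ → V G → Set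
  LinkDown o d zero r w = L w ≡ tri (suc d) (up o)
  LinkDown o d (suc m) r w = L w ≡ link o d m (suc r)

  LinkUp : ℕ → ℕ → ℕ → ℕ → V G → Set
  LinkUp o d m zero w = (L w ≡ tri d down) × (toℕ w ≡ o)
  LinkUp o d m (suc r) w = L w ≡ link o d (suc m) r

  LinkCond : V G → ℕ → ℕ → ℕ → ℕ → Set
  LinkCond x o d m r = (deg G x ≡ 2) × (Σ (V G) λ w → Adj G x w × LinkDown o d m r w) ×
     (Σ (V G) λ w → Adj G x w × LinkUp o d m r w)

  CondAt : V G → Label → Set
  CondAt x (tri d br) = TriCond x d br
  CondAt x (pend o j) = PendCond x o j
  CondAt x (link o d m r) = LinkCond x o d m r

  Cond : V G → Set
  Cond x = CondAt x (L x)

LooplessEdges : Graph → Set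
LooplessEdges G = All (λ e → proj₁ e ≢ proj₂ e) (E G)

loopless : ∀ G → LooplessEdges G → Loopless G
loopless G nl x (inj₁ p) = All.lookup nl p refl
loopless G nl x (inj₂ p) = All.lookup nl p refl

Labelled : Graph → Set
Labelled G = LooplessEdges G × Σ (ℕ → Label) λ ℓ → ∀ x → Invariant.Cond G ℓ x

mapE : ∀ {m m′} → (Fin m → Fin m′) → List (Fin m × Fin m) → List (Fin m′ × Fin m′)
mapE ι = map (λ e → ι (proj₁ e) , ι (proj₂ e))

degL-++ : ∀ {m} (v : Fin m) xs ys → degL v (xs ++ ys) ≡ degL v xs + degL v ys
degL-++ v [] ys = refl
degL-++ v ((a , b) ∷ xs) ys = trans (cong (_ +_) (degL-++ v xs ys)) (sym (+-assoc _ (degL v xs) (degL v ys)))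

does-≟-injective : ∀ {m m′} (ι : Fin m → Fin m′) → (∀ {a b} → ι a ≡ ι b → a ≡ b) →
  ∀ a x → does (ι a ≟ ι x) ≡ does (a ≟ x)
does-≟-injective ι ι-inj a x with a ≟ x
... | yes refl = dec-true (ι a ≟ ι a) refl
... | no a≢x = dec-false (ι a ≟ ι x) (a≢x ∘ ι-inj)

degL-mapE : ∀ {m m′} (ι : Fin m → Fin m′) → (∀ {a b} → ι a ≡ ι b → a ≡ b) →
  ∀ x es → degL (ι x) (mapE ι es) ≡ degL x es
degL-mapE ι ι-inj x [] = refl
degL-mapE ι ι-inj x ((a , b) ∷ es) rewrite does-≟-injective ι ι-inj a x | does-≟-injective ι ι-inj b x =
  cong (_ +_) (degL-mapE ι ι-inj x es)

degL-mapE-fresh : ∀ {m m′} (ι : Fin m → Fin m′) (y : Fin m′) → (∀ a → ι a ≢ y) → ∀ es → degL y (mapE ι es) ≡ 0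
degL-mapE-fresh ι y fresh [] = refl
degL-mapE-fresh ι y fresh ((a , b) ∷ es)
  rewrite dec-false (ι a ≟ y) (fresh a) | dec-false (ι b ≟ y) (fresh b) = degL-mapE-fresh ι y fresh es

module Extension {G G′ : Graph} (ι : V G → V G′) (ι-injective : ∀ {a b} → ι a ≡ ι b → a ≡ b)
  (new : List (V G′ × V G′)) (E≡ : E G′ ≡ mapE ι (E G) ++ new) where

  adj-ι : ∀ {a b} → Adj G a b → Adj G′ (ι a) (ι b)
  adj-ι (inj₁ p) = inj₁ (subst ((_ , _) ∈_) (sym E≡) (∈-++⁺ˡ (∈-map⁺ _ p)))
  adj-ι (inj₂ p) = inj₂ (subst ((_ , _) ∈_) (sym E≡) (∈-++⁺ˡ (∈-map⁺ _ p)))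

  adj-new : ∀ {a b} → (a , b) ∈ new → Adj G′ a b
  adj-new p = inj₁ (subst ((_ , _) ∈_) (sym E≡) (∈-++⁺ʳ (mapE ι (E G)) p))

  deg-ι : ∀ x → deg G′ (ι x) ≡ deg G x + degL (ι x) new
  deg-ι x rewrite E≡ = trans (degL-++ (ι x) (mapE ι (E G)) new) (cong (_+ degL (ι x) new) (degL-mapE ι ι-injective x (E G)))

  deg-fresh : ∀ y → (∀ a → ι a ≢ y) → deg G′ y ≡ degL y new
  deg-fresh y fresh rewrite E≡ = trans (degL-++ y (mapE ι (E G)) new) (cong (_+ degL y new) (degL-mapE-fresh ι y fresh (E G)))

  looplessEdges : LooplessEdges G → All (λ e → proj₁ e ≢ proj₂ e) new → LooplessEdges G′
  looplessEdges nl nl-new = subst (All _) (sym E≡) (++⁺ (map⁺ (All.map (_∘ ι-injective) nl)) nl-new)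

-- the one relabelling the construction performs: a branchless triangle vertex receives a branch
-- other than the one up to its parent
Relabels : Label → Label → Set
Relabels A B = (B ≡ A) ⊎ (Σ ℕ λ d → (A ≡ tri d none) × Σ Branch λ br → (B ≡ tri d br) × ¬ IsUp br)

module Transport (G G′ : Graph) (ℓ ℓ′ : ℕ → Label) (ι : V G → V G′)
  (toℕ-ι : ∀ a → toℕ (ι a) ≡ toℕ a)
  (adj-ι : ∀ {a b} → Adj G a b → Adj G′ (ι a) (ι b))
  (relabels : ∀ (a : V G) → Relabels (ℓ (toℕ a)) (ℓ′ (toℕ a))) where

  open Invariant G ℓ
  module I′ = Invariant G′ ℓ′

  L′-ι : ∀ a → I′.L (ι a) ≡ ℓ′ (toℕ a)
  L′-ι a = cong ℓ′ (toℕ-ι a)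

  ι-injective : ∀ {a b} → ι a ≡ ι b → a ≡ b
  ι-injective q = toℕ-injective (trans (sym (toℕ-ι _)) (trans (cong toℕ q) (toℕ-ι _)))

  keep : ∀ {a X} → L a ≡ X → (∀ d → X ≢ tri d none) → I′.L (ι a) ≡ X
  keep {a} e branched with relabels a
  ... | inj₁ q = trans (L′-ι a) (trans q e)
  ... | inj₂ (d , q , _) = ⊥-elim (branched d (trans (sym e) q))

  keep-owner : ∀ {a X} (F : ℕ → Label) → L a ≡ F (toℕ X) → (∀ d → F (toℕ X) ≢ tri d none) → I′.L (ι a) ≡ F (toℕ (ι X))
  keep-owner {X = X} F e branched = trans (keep e branched) (cong F (sym (toℕ-ι X)))

  keepMate : ∀ {a d br} → Mate d br a → I′.Mate d br (ι a)
  keepMate {a} (br′ , e , h) with relabels a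
  ... | inj₁ q = br′ , trans (L′-ι a) (trans q e) , h
  ... | inj₂ (d′ , q , br″ , q′ , not-up) with trans (sym e) q
  ...   | refl = br″ , trans (L′-ι a) q′ , λ _ → not-up

  keepBranchStart : ∀ {d br x p} → BranchStart d br x p → I′.BranchStart d br (ι x) (ι p)
  keepBranchStart {br = pendant} (j , e , odd) = j , keep-owner (λ o → pend o j) e (λ _ ()) , odd
  keepBranchStart {d} {down} (inj₁ (m , e , odd)) = inj₁ (m , keep-owner (λ o → link o d m 0) e (λ _ ()) , odd)
  keepBranchStart {d} {down} (inj₂ e) = inj₂ (keep-owner (λ o → tri (suc d) (up o)) e (λ _ ()))
  keepBranchStart {br = up o} (d′ , q , inj₁ (r , e , odd)) = d′ , q , inj₁ (r , keep e (λ _ ()) , odd)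
  keepBranchStart {br = up o} {p = p} (d′ , q , inj₂ (e , t)) = d′ , q , inj₂ (keep e (λ _ ()) , trans (toℕ-ι p) t)

  keepBranchCond : ∀ {x d} br → deg G′ (ι x) ≡ deg G x → BranchCond x d br → I′.BranchCond (ι x) d br
  keepBranchCond none dg dx = trans dg dx
  keepBranchCond {x} {d} pendant dg (dx , p , xp , bs) = trans dg dx , ι p , adj-ι xp , keepBranchStart {d} {pendant} {x} {p} bs
  keepBranchCond {x} {d} down dg (dx , p , xp , bs) = trans dg dx , ι p , adj-ι xp , keepBranchStart {d} {down} {x} {p} bs
  keepBranchCond {x} {d} (up o) dg (dx , p , xp , bs) = trans dg dx , ι p , adj-ι xp , keepBranchStart {d} {up o} {x} {p} bs

  keepPendUp : ∀ {o j w} → PendUp o j w → I′.PendUp o j (ι w)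
  keepPendUp (inj₁ e) = inj₁ (keep e (λ _ ()))
  keepPendUp {w = w} (inj₂ (d , e , t)) = inj₂ (d , keep e (λ _ ()) , trans (toℕ-ι w) t)

  keepLinkDown : ∀ {o d m r w} → LinkDown o d m r w → I′.LinkDown o d m r (ι w)
  keepLinkDown {m = zero} e = keep e (λ _ ())
  keepLinkDown {m = suc m} e = keep e (λ _ ())

  keepLinkUp : ∀ {o d m r w} → LinkUp o d m r w → I′.LinkUp o d m r (ι w)
  keepLinkUp {r = zero} {w} (e , t) = keep e (λ _ ()) , trans (toℕ-ι w) t
  keepLinkUp {r = suc r} e = keep e (λ _ ())

  keepCondAt : ∀ x → deg G′ (ι x) ≡ deg G x → ∀ X → CondAt x X → I′.CondAt (ι x) X
  keepCondAt x dg (tri d br) (y , z , y≢z , xy , xz , yz , my , mz , bc) =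
    ι y , ι z , y≢z ∘ ι-injective , adj-ι xy , adj-ι xz , adj-ι yz , keepMate my , keepMate mz , keepBranchCond br dg bc
  keepCondAt x dg (pend o zero) (dx , w , xw , e) = trans dg dx , ι w , adj-ι xw , keep e (λ _ ())
  keepCondAt x dg (pend o (suc j)) (dx , (w₁ , a₁ , e₁) , (w₂ , a₂ , e₂)) =
    trans dg dx , (ι w₁ , adj-ι a₁ , keep e₁ (λ _ ())) , (ι w₂ , adj-ι a₂ , keepPendUp e₂)
  keepCondAt x dg (link o d m r) (dx , (w₁ , a₁ , e₁) , (w₂ , a₂ , e₂)) =
    trans dg dx , (ι w₁ , adj-ι a₁ , keepLinkDown {m = m} e₁) , (ι w₂ , adj-ι a₂ , keepLinkUp {r = r} e₂)

  keepCond : ∀ x → deg G′ (ι x) ≡ deg G x → ℓ′ (toℕ x) ≡ ℓ (toℕ x) → Cond x → I′.Cond (ι x)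
  keepCond x dg same c = subst (I′.CondAt (ι x)) (sym (trans (L′-ι x) same)) (keepCondAt x dg (L x) c)

-- Local structure of a labelled graph

module Structure (G : Graph) (ℓ : ℕ → Label) (nlL : LooplessEdges G) (lc : ∀ x → Invariant.Cond G ℓ x) where
  open Invariant G ℓ

  nl : Loopless G
  nl = loopless G nlL

  adj⇒≢ : ∀ {x y} → Adj G x y → x ≢ y
  adj⇒≢ {x} a refl = nl x a

  ≢-by-label : ∀ {a b A B} → L a ≡ A → L b ≡ B → A ≢ B → a ≢ b
  ≢-by-label ea eb A≢B refl = A≢B (trans (sym ea) eb)

  label-clash : ∀ {a A B} → L a ≡ A → L a ≡ B → A ≢ B → ⊥
  label-clash ea eb A≢B = ≢-by-label ea eb A≢B refl

  condAt : ∀ {w X} → L w ≡ X → CondAt w X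
  condAt {w} e = subst (CondAt w) e (lc w)

  mate≢branch : ∀ {x y p d br br′} → L y ≡ tri d br′ → BranchStart d br x p → y ≢ p
  mate≢branch {br = pendant} ey (j , e , _) = ≢-by-label ey e (λ ())
  mate≢branch {br = down} ey (inj₁ (m , e , _)) = ≢-by-label ey e (λ ())
  mate≢branch {br = down} ey (inj₂ e) = ≢-by-label ey e (λ q → n≢1+n _ (cong depth q))
  mate≢branch {br = up o} ey (d′ , refl , inj₁ (r , e , _)) = ≢-by-label ey e (λ ())
  mate≢branch {br = up o} ey (d′ , refl , inj₂ (e , _)) = ≢-by-label ey e (λ q → n≢1+n _ (sym (cong depth q)))

  NeighbourList : V G → Set
  NeighbourList x = Σ (List (V G)) λ ws → Unique ws × All (Adj G x) ws × (length ws ≡ deg G x)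

  neighbourList : ∀ x X → CondAt x X → NeighbourList x
  neighbourList x (tri d br) (y , z , y≢z , xy , xz , _ , (_ , ey , _) , (_ , ez , _) , bc) = withBranch br bc
    where
    branched : ∀ br {p} → deg G x ≡ 3 → Adj G x p → BranchStart d br x p → NeighbourList x
    branched br {p} dx xp bs = (y ∷ z ∷ p ∷ []) ,
      ((y≢z ∷ mate≢branch {x} {d = d} {br} ey bs ∷ []) ∷ (mate≢branch {x} {d = d} {br} ez bs ∷ []) ∷ [] ∷ []) ,
      (xy ∷ xz ∷ xp ∷ []) , sym dx
    withBranch : ∀ br → BranchCond x d br → NeighbourList x
    withBranch none dx = (y ∷ z ∷ []) , ((y≢z ∷ []) ∷ [] ∷ []) , (xy ∷ xz ∷ []) , sym dx
    withBranch pendant (dx , _ , xp , bs) = branched pendant dx xp bs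
    withBranch down (dx , _ , xp , bs) = branched down dx xp bs
    withBranch (up o) (dx , _ , xp , bs) = branched (up o) dx xp bs
  neighbourList x (pend o zero) (dx , w , xw , _) = (w ∷ []) , ([] ∷ []) , (xw ∷ []) , sym dx
  neighbourList x (pend o (suc j)) (dx , (w₁ , a₁ , e₁) , (w₂ , a₂ , e₂)) =
    (w₁ ∷ w₂ ∷ []) , ((w₁≢w₂ e₂ ∷ []) ∷ [] ∷ []) , (a₁ ∷ a₂ ∷ []) , sym dx
    where
    w₁≢w₂ : PendUp o j w₂ → w₁ ≢ w₂
    w₁≢w₂ (inj₁ e₂) = ≢-by-label e₁ e₂ (λ q → n≢2+n j (cong pendPos q))
    w₁≢w₂ (inj₂ (_ , e₂ , _)) = ≢-by-label e₁ e₂ (λ ())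
  neighbourList x (link o d m r) (dx , (w₁ , a₁ , e₁) , (w₂ , a₂ , e₂)) =
    (w₁ ∷ w₂ ∷ []) , ((w₁≢w₂ m r e₁ e₂ ∷ []) ∷ [] ∷ []) , (a₁ ∷ a₂ ∷ []) , sym dx
    where
    w₁≢w₂ : ∀ m r → LinkDown o d m r w₁ → LinkUp o d m r w₂ → w₁ ≢ w₂
    w₁≢w₂ zero zero e₁ (e₂ , _) = ≢-by-label e₁ e₂ (λ ())
    w₁≢w₂ zero (suc r) e₁ e₂ = ≢-by-label e₁ e₂ (λ ())
    w₁≢w₂ (suc m) zero e₁ (e₂ , _) = ≢-by-label e₁ e₂ (λ ())
    w₁≢w₂ (suc m) (suc r) e₁ e₂ = ≢-by-label e₁ e₂ (λ q → n≢2+n m (cong linkBelow q))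

  neighbourList-complete : ∀ {x X} (c : CondAt x X) {w} → Adj G x w → w ∈ proj₁ (neighbourList x X c)
  neighbourList-complete {x} {X} c a with neighbourList x X c
  ... | ws , u , ps , len = neighbour-complete G nl u ps len a

  ∈1 : ∀ {w a : V G} → w ∈ (a ∷ []) → w ≡ a
  ∈1 (here p) = p

  ∈2 : ∀ {w a b : V G} → w ∈ (a ∷ b ∷ []) → (w ≡ a) ⊎ (w ≡ b)
  ∈2 (here p) = inj₁ p
  ∈2 (there (here p)) = inj₂ p

  ∈3 : ∀ {w a b c : V G} → w ∈ (a ∷ b ∷ c ∷ []) → (w ≡ a) ⊎ (w ≡ b) ⊎ (w ≡ c)
  ∈3 (here p) = inj₁ p
  ∈3 (there (here p)) = inj₂ (inj₁ p)
  ∈3 (there (there (here p))) = inj₂ (inj₂ p)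

  record PendView (P : V G) (o j : ℕ) : Set where
    field
      far near : V G
      far-adj : Adj G P far
      far-label : L far ≡ pend o j
      near-adj : Adj G P near
      near-label : PendUp o j near
      degree : deg G P ≡ 2
      only : ∀ {z} → Adj G P z → (z ≡ far) ⊎ (z ≡ near)

  pendView : ∀ {P o j} → L P ≡ pend o (suc j) → PendView P o j
  pendView {P} {o} {j} e with condAt e
  ... | c@(dx , (w₁ , a₁ , e₁) , (w₂ , a₂ , e₂)) = record
    { far = w₁ ; near = w₂ ; far-adj = a₁ ; far-label = e₁ ; near-adj = a₂ ; near-label = e₂ ; degree = dx
    ; only = ∈2 ∘ neighbourList-complete {X = pend o (suc j)} c }

  record PendEndView (P : V G) (o : ℕ) : Set where
    field
      near : V G
      near-adj : Adj G P near
      near-label : L near ≡ pend o 1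
      degree : deg G P ≡ 1
      only : ∀ {z} → Adj G P z → z ≡ near

  pendEndView : ∀ {P o} → L P ≡ pend o 0 → PendEndView P o
  pendEndView {P} {o} e with condAt e
  ... | c@(dx , w , a , ew) = record
    { near = w ; near-adj = a ; near-label = ew ; degree = dx ; only = ∈1 ∘ neighbourList-complete {X = pend o 0} c }

  record LinkView (P : V G) (o d m r : ℕ) : Set where
    field
      below above : V G
      below-adj : Adj G P below
      below-label : LinkDown o d m r below
      above-adj : Adj G P above
      above-label : LinkUp o d m r above
      degree : deg G P ≡ 2
      only : ∀ {z} → Adj G P z → (z ≡ below) ⊎ (z ≡ above)

  linkView : ∀ {P o d m r} → L P ≡ link o d m r → LinkView P o d m r
  linkView {P} {o} {d} {m} {r} e with condAt e
  ... | c@(dx , (w₁ , a₁ , e₁) , (w₂ , a₂ , e₂)) = record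
    { below = w₁ ; above = w₂ ; below-adj = a₁ ; below-label = e₁ ; above-adj = a₂ ; above-label = e₂ ; degree = dx
    ; only = ∈2 ∘ neighbourList-complete {X = link o d m r} c }

  record TriangleView (P : V G) (d : ℕ) (br : Branch) : Set where
    field
      y z : V G
      y≢z : y ≢ z
      adj-y : Adj G P y
      adj-z : Adj G P z
      adj-yz : Adj G y z
      mate-y : Mate d br y
      mate-z : Mate d br z

    label-y : L y ≡ tri d (proj₁ mate-y)
    label-y = proj₁ (proj₂ mate-y)

    label-z : L z ≡ tri d (proj₁ mate-z)
    label-z = proj₁ (proj₂ mate-z)

  record BranchedView (P : V G) (d : ℕ) (br : Branch) : Set where
    field
      triangle : TriangleView P d br
      branch : V G
      branch-adj : Adj G P branch
      branch-start : BranchStart d br P branch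
      degree : deg G P ≡ 3
      only : ∀ {w} → Adj G P w → (w ≡ TriangleView.y triangle) ⊎ (w ≡ TriangleView.z triangle) ⊎ (w ≡ branch)

  record UnbranchedView (P : V G) (d : ℕ) : Set where
    field
      triangle : TriangleView P d none
      degree : deg G P ≡ 2
      only : ∀ {w} → Adj G P w → (w ≡ TriangleView.y triangle) ⊎ (w ≡ TriangleView.z triangle)

  TriView : V G → ℕ → Branch → Set
  TriView P d none = UnbranchedView P d
  TriView P d pendant = BranchedView P d pendant
  TriView P d down = BranchedView P d down
  TriView P d (up o) = BranchedView P d (up o)

  triView : ∀ {P d br} → L P ≡ tri d br → TriView P d br
  triView {P} {d} {br} e = view br (condAt e)
    where
    triangleOf : ∀ {br} → TriCond P d br → TriangleView P d br
    triangleOf (y , z , y≢z , ay , az , ayz , my , mz , _) =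
      record { y = y ; z = z ; y≢z = y≢z ; adj-y = ay ; adj-z = az ; adj-yz = ayz ; mate-y = my ; mate-z = mz }
    branchedOf : ∀ {br p} (c : TriCond P d br) → deg G P ≡ 3 → Adj G P p → BranchStart d br P p →
      (∀ {w} → Adj G P w → w ∈ proj₁ c ∷ proj₁ (proj₂ c) ∷ p ∷ []) → BranchedView P d br
    branchedOf c dx ap bs complete = record
      { triangle = triangleOf c ; branch = _ ; branch-adj = ap ; branch-start = bs ; degree = dx ; only = ∈3 ∘ complete }
    view : ∀ br → CondAt P (tri d br) → TriView P d br
    view none c@(_ , _ , _ , _ , _ , _ , _ , _ , dx) =
      record { triangle = triangleOf c ; degree = dx ; only = ∈2 ∘ neighbourList-complete {X = tri d none} c }
    view pendant c@(_ , _ , _ , _ , _ , _ , _ , _ , dx , _ , ap , bs) =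
      branchedOf c dx ap bs (neighbourList-complete {X = tri d pendant} c)
    view down c@(_ , _ , _ , _ , _ , _ , _ , _ , dx , _ , ap , bs) =
      branchedOf c dx ap bs (neighbourList-complete {X = tri d down} c)
    view (up o) c@(_ , _ , _ , _ , _ , _ , _ , _ , dx , _ , ap , bs) =
      branchedOf c dx ap bs (neighbourList-complete {X = tri d (up o)} c)

  triangleView : ∀ {P d br} → L P ≡ tri d br → TriangleView P d br
  triangleView {br = none} e = UnbranchedView.triangle (triView e)
  triangleView {br = pendant} e = BranchedView.triangle (triView e)
  triangleView {br = down} e = BranchedView.triangle (triView e)
  triangleView {br = up o} e = BranchedView.triangle (triView e)

  child-not-above : ∀ {w o d m br} r → L w ≡ tri (suc d) br → LinkUp o d m r w → ⊥
  child-not-above {d = d} zero e (e′ , _) = label-clash e e′ (λ q → n≢1+n d (sym (cong depth q)))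
  child-not-above (suc r) e e′ = label-clash e e′ (λ ())

  parent-not-below : ∀ {w o d r br} m → L w ≡ tri d br → LinkDown o d m r w → ⊥
  parent-not-below {d = d} zero e e′ = label-clash e e′ (λ q → n≢1+n d (cong depth q))
  parent-not-below (suc m) e e′ = label-clash e e′ (λ ())

  branch-not-adj-mate : ∀ {x P z d br} → BranchStart d br x P → Mate d br z → Adj G x z → Adj G P z → ⊥
  branch-not-adj-mate {br = pendant} (zero , e , ()) _ _ _
  branch-not-adj-mate {br = pendant} (suc j , e , _) (_ , ez , _) xz Pz with pendView e
  ... | v with PendView.only v Pz
  ...   | inj₁ refl = label-clash ez (PendView.far-label v) (λ ())
  ...   | inj₂ refl with PendView.near-label v
  ...     | inj₁ e′ = label-clash ez e′ (λ ())
  ...     | inj₂ (_ , _ , t) = adj⇒≢ xz (toℕ-injective (sym t))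
  branch-not-adj-mate {br = down} (inj₁ (m , e , _)) (_ , ez , _) xz Pz with linkView e
  ... | v with LinkView.only v Pz
  ...   | inj₁ refl = parent-not-below m ez (LinkView.below-label v)
  ...   | inj₂ refl = adj⇒≢ xz (toℕ-injective (sym (proj₂ (LinkView.above-label v))))
  branch-not-adj-mate {d = d} {br = down} (inj₂ e) (_ , ez , _) xz Pz with triView e
  ... | v with BranchedView.only v Pz
  ...   | inj₁ refl = label-clash ez (TriangleView.label-y (BranchedView.triangle v)) (λ q → n≢1+n d (cong depth q))
  ...   | inj₂ (inj₁ refl) = label-clash ez (TriangleView.label-z (BranchedView.triangle v)) (λ q → n≢1+n d (cong depth q))
  ...   | inj₂ (inj₂ refl) with BranchedView.branch-start v
  ...     | _ , refl , inj₁ (_ , e′ , _) = label-clash ez e′ (λ ())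
  ...     | _ , refl , inj₂ (_ , t) = adj⇒≢ xz (toℕ-injective (sym t))
  branch-not-adj-mate {br = up o} (d′ , refl , inj₁ (r , e , _)) (_ , ez , not-up) xz Pz with linkView e
  ... | v with LinkView.only v Pz
  ...   | inj₂ refl = child-not-above r ez (LinkView.above-label v)
  ...   | inj₁ refl with trans (sym ez) (LinkView.below-label v)
  ...     | refl = not-up tt tt
  branch-not-adj-mate {br = up o} (d′ , refl , inj₂ (e , _)) (_ , ez , not-up) xz Pz with triView e
  ... | v with BranchedView.only v Pz
  ...   | inj₁ refl = label-clash ez (TriangleView.label-y (BranchedView.triangle v)) (λ q → n≢1+n d′ (sym (cong depth q)))
  ...   | inj₂ (inj₁ refl) = label-clash ez (TriangleView.label-z (BranchedView.triangle v)) (λ q → n≢1+n d′ (sym (cong depth q)))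
  ...   | inj₂ (inj₂ refl) with BranchedView.branch-start v
  ...     | inj₁ (_ , e′ , _) = label-clash ez e′ (λ ())
  ...     | inj₂ e′ with trans (sym ez) e′
  ...       | refl = not-up tt tt

  TriangleAt : V G → V G → V G → Set
  TriangleAt x y z = Σ ℕ λ d → Σ Branch λ br → (L x ≡ tri d br) × Mate d br y × Mate d br z

  adj-between : ∀ {y z a b : V G} → y ≢ z → (y ≡ a) ⊎ (y ≡ b) → (z ≡ a) ⊎ (z ≡ b) → Adj G y z → Adj G a b
  adj-between yz (inj₁ refl) (inj₁ refl) _ = ⊥-elim (yz refl)
  adj-between yz (inj₁ refl) (inj₂ refl) a = a
  adj-between yz (inj₂ refl) (inj₁ refl) a = adj-sym a
  adj-between yz (inj₂ refl) (inj₂ refl) _ = ⊥-elim (yz refl)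

  mate-unless-branch : ∀ {x d br w} (tb : BranchedView x d br) → Adj G x w → w ≢ BranchedView.branch tb → Mate d br w
  mate-unless-branch tb a w≢p with BranchedView.only tb a
  ... | inj₁ refl = TriangleView.mate-y (BranchedView.triangle tb)
  ... | inj₂ (inj₁ refl) = TriangleView.mate-z (BranchedView.triangle tb)
  ... | inj₂ (inj₂ q) = ⊥-elim (w≢p q)

  triangleAt-branched : ∀ {x y z d br} → L x ≡ tri d br → BranchedView x d br →
    Adj G x y → Adj G x z → Adj G y z → y ≢ z → TriangleAt x y z
  triangleAt-branched {x} {d = d} {br} e tb xy xz yz y≢z = d , br , e , mate xy xz yz y≢z , mate xz xy (adj-sym yz) (y≢z ∘ sym)
    where
    mate : ∀ {u v} → Adj G x u → Adj G x v → Adj G u v → u ≢ v → Mate d br u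
    mate xu xv uv u≢v = mate-unless-branch tb xu λ { refl →
      branch-not-adj-mate (BranchedView.branch-start tb) (mate-unless-branch tb xv λ { refl → u≢v refl }) xv uv }

  pend-neighbours-nonadjacent : ∀ {x o j} (v : PendView x o j) → L x ≡ pend o (suc j) →
    ¬ Adj G (PendView.far v) (PendView.near v)
  pend-neighbours-nonadjacent {j = zero} v lx a = adj⇒≢ (PendView.near-adj v)
    (trans (PendEndView.only end (adj-sym (PendView.far-adj v))) (sym (PendEndView.only end a)))
    where end = pendEndView (PendView.far-label v)
  pend-neighbours-nonadjacent {j = suc j} v lx a with pendView (PendView.far-label v)
  ... | v′ with PendView.only v′ (adj-sym (PendView.far-adj v))
  ...   | inj₁ refl = label-clash lx (PendView.far-label v′) (λ q → n≢2+n _ (sym (cong pendPos q)))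
  ...   | inj₂ refl with PendView.only v′ a
  ...     | inj₂ q = adj⇒≢ (PendView.near-adj v) (sym q)
  ...     | inj₁ refl with PendView.near-label v
  ...       | inj₁ e = label-clash e (PendView.far-label v′) (λ q → n≢3+n _ (sym (cong pendPos q)))
  ...       | inj₂ (_ , e , _) = label-clash e (PendView.far-label v′) (λ ())

  link-neighbours-nonadjacent : ∀ {x o d m r} (v : LinkView x o d m r) → L x ≡ link o d m r →
    ¬ Adj G (LinkView.below v) (LinkView.above v)
  link-neighbours-nonadjacent {x} {o} {d} {suc m} {r} v lx a with linkView (LinkView.below-label v)
  ... | v′ with LinkView.only v′ (adj-sym (LinkView.below-adj v))
  ...   | inj₁ refl = x-not-below m lx (LinkView.below-label v′)
    where
    x-not-below : ∀ m → L x ≡ link o d (suc m) r → LinkDown o d m (suc r) x → ⊥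
    x-not-below zero lx e = label-clash lx e (λ ())
    x-not-below (suc m) lx e = label-clash lx e (λ q → n≢2+n _ (sym (cong linkBelow q)))
  ...   | inj₂ refl with LinkView.only v′ a
  ...     | inj₂ q = adj⇒≢ (LinkView.above-adj v) (sym q)
  ...     | inj₁ refl = up≠down m r (LinkView.above-label v) (LinkView.below-label v′)
    where
    up≠down : ∀ {w} m r → LinkUp o d (suc m) r w → LinkDown o d m (suc r) w → ⊥
    up≠down zero zero (e , _) e′ = label-clash e e′ (λ q → n≢1+n d (cong depth q))
    up≠down (suc m) zero (e , _) e′ = label-clash e e′ (λ ())
    up≠down zero (suc r) e e′ = label-clash e e′ (λ ())
    up≠down (suc m) (suc r) e e′ = label-clash e e′ (λ q → n≢3+n _ (sym (cong linkBelow q)))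
  link-neighbours-nonadjacent {x} {o} {d} {zero} {r} v lx a with triView (LinkView.below-label v)
  ... | tb with BranchedView.only tb (adj-sym (LinkView.below-adj v))
  ...   | inj₁ refl = label-clash lx (TriangleView.label-y (BranchedView.triangle tb)) (λ ())
  ...   | inj₂ (inj₁ refl) = label-clash lx (TriangleView.label-z (BranchedView.triangle tb)) (λ ())
  ...   | inj₂ (inj₂ refl) with BranchedView.only tb a
  ...     | inj₁ refl = child-not-above r (TriangleView.label-y (BranchedView.triangle tb)) (LinkView.above-label v)
  ...     | inj₂ (inj₁ refl) = child-not-above r (TriangleView.label-z (BranchedView.triangle tb)) (LinkView.above-label v)
  ...     | inj₂ (inj₂ q) = adj⇒≢ (LinkView.above-adj v) (sym q)

  triangleAt : ∀ {x y z} → Adj G x y → Adj G x z → Adj G y z → y ≢ z → TriangleAt x y z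
  triangleAt {x} {y} {z} xy xz yz y≢z = go (L x) refl
    where
    go : ∀ X → L x ≡ X → TriangleAt x y z
    go (tri d none) e = d , none , e , mate (UnbranchedView.only t xy) , mate (UnbranchedView.only t xz)
      where
      t = triView e
      mate : ∀ {w} → (w ≡ TriangleView.y (UnbranchedView.triangle t)) ⊎ (w ≡ TriangleView.z (UnbranchedView.triangle t)) → Mate d none w
      mate (inj₁ refl) = TriangleView.mate-y (UnbranchedView.triangle t)
      mate (inj₂ refl) = TriangleView.mate-z (UnbranchedView.triangle t)
    go (tri d pendant) e = triangleAt-branched e (triView e) xy xz yz y≢z
    go (tri d down) e = triangleAt-branched e (triView e) xy xz yz y≢z
    go (tri d (up o)) e = triangleAt-branched e (triView e) xy xz yz y≢z
    go (pend o zero) e = ⊥-elim (y≢z (trans (PendEndView.only v xy) (sym (PendEndView.only v xz))))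
      where v = pendEndView e
    go (pend o (suc j)) e = ⊥-elim (pend-neighbours-nonadjacent v e (adj-between y≢z (PendView.only v xy) (PendView.only v xz) yz))
      where v = pendView e
    go (link o d m r) e = ⊥-elim (link-neighbours-nonadjacent v e (adj-between y≢z (LinkView.only v xy) (LinkView.only v xz) yz))
      where v = linkView e

  same-depth-neighbour : ∀ {x d br w br′} (tb : BranchedView x d br) → Adj G x w → L w ≡ tri d br′ →
    (w ≡ TriangleView.y (BranchedView.triangle tb)) ⊎ (w ≡ TriangleView.z (BranchedView.triangle tb))
  same-depth-neighbour {br = br} tb a e with BranchedView.only tb a
  ... | inj₁ q = inj₁ q
  ... | inj₂ (inj₁ q) = inj₂ q
  ... | inj₂ (inj₂ q) = ⊥-elim (mate≢branch {br = br} e (BranchedView.branch-start tb) q)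

  edge-unique : ∀ {e e′ x w} → Joins G e x w → Joins G e′ x w → e ≡ e′
  edge-unique {x = x} with neighbourList x (L x) (lc x)
  ... | ws , u , ps , len = neighbours⇒edge-unique G nl u ps len

  branchless-of-deg2 : ∀ {v d br} → L v ≡ tri d br → deg G v ≡ 2 → br ≡ none
  branchless-of-deg2 {br = none} _ _ = refl
  branchless-of-deg2 {br = pendant} e d2 with trans (sym (BranchedView.degree (triView e))) d2
  ... | ()
  branchless-of-deg2 {br = down} e d2 with trans (sym (BranchedView.degree (triView e))) d2
  ... | ()
  branchless-of-deg2 {br = up o} e d2 with trans (sym (BranchedView.degree (triView e))) d2
  ... | ()

  branchless-triangle-vertex : ∀ {v} → deg G v ≡ 2 → OnTriangle G v → Σ ℕ λ d → L v ≡ tri d none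
  branchless-triangle-vertex d2 (a , b , va , vb , ab) with triangleAt va vb ab (λ { refl → nl a ab })
  ... | d , br , e , _ with branchless-of-deg2 e d2
  ...   | refl = d , e

module Triangles (G : Graph) (ℓ : ℕ → Label) (nlL : LooplessEdges G) (lc : ∀ x → Invariant.Cond G ℓ x) where
  open Invariant G ℓ
  open Structure G ℓ nlL lc

  triangle-mate : ∀ {T x w} → IsTriangle G T → InTri G x T → InTri G w T → x ≢ w →
    Σ ℕ λ d → Σ Branch λ br → (L x ≡ tri d br) × Mate d br w
  triangle-mate {T} {x} {w} it ix iw ne with otherTwo it ix
  ... | o with triangleAt (OtherTwo.adj-u o) (OtherTwo.adj-v o) (OtherTwo.adj-uv o) (OtherTwo.u≢v o) | OtherTwo.only o iw
  ...   | d , br , e , tu , tv | inj₁ q = ⊥-elim (ne (sym q))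
  ...   | d , br , e , tu , tv | inj₂ (inj₁ refl) = d , br , e , tu
  ...   | d , br , e , tu , tv | inj₂ (inj₂ refl) = d , br , e , tv

  triangle-label : ∀ {T x} → IsTriangle G T → InTri G x T → Σ ℕ λ d → Σ Branch λ br → L x ≡ tri d br
  triangle-label it ix with otherTwo it ix
  ... | o with triangle-mate it ix (OtherTwo.u∈T o) (λ q → adj⇒≢ (OtherTwo.adj-u o) q)
  ...   | d , br , e , _ = d , br , e

  same-depth-pair : ∀ {x d br} → L x ≡ tri d br → Σ (V G) λ y → Σ (V G) λ z →
    ∀ {w br′} → Adj G x w → L w ≡ tri d br′ → (w ≡ y) ⊎ (w ≡ z)
  same-depth-pair {br = none} e = _ , _ , λ a _ → UnbranchedView.only (triView e) a
  same-depth-pair {br = pendant} e = _ , _ , same-depth-neighbour (triView e)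
  same-depth-pair {br = down} e = _ , _ , same-depth-neighbour (triView e)
  same-depth-pair {br = up o} e = _ , _ , same-depth-neighbour (triView e)

  triangle-⊆ : ∀ {T1 T3 x} → IsTriangle G T1 → IsTriangle G T3 → InTri G x T1 → InTri G x T3 →
    ∀ {w} → InTri G w T1 → InTri G w T3
  triangle-⊆ {T1} {T3} {x} it1 it3 ix1 ix3 {w} iw with otherTwo it1 ix1 | otherTwo it3 ix3
  ... | o1 | o3 with triangle-mate it1 ix1 (OtherTwo.u∈T o1) (λ q → adj⇒≢ (OtherTwo.adj-u o1) q)
  ...   | d , br , ex , _ with same-depth-pair ex
  ...     | y , z , cmpx = go (OtherTwo.only o1 iw)
    where
    same-depth : ∀ {T} {n} → IsTriangle G T → InTri G x T → InTri G n T → x ≢ n → Σ Branch λ br′ → L n ≡ tri d br′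
    same-depth it ix n∈T ne with triangle-mate it ix n∈T ne
    ... | d′ , br1 , ex′ , (br′ , en , _) with trans (sym ex) ex′
    ...   | refl = br′ , en
    pos : ∀ {T} {n} → IsTriangle G T → InTri G x T → InTri G n T → Adj G x n → (n ≡ y) ⊎ (n ≡ z)
    pos it ix n∈T a = cmpx a (proj₂ (same-depth it ix n∈T (adj⇒≢ a)))
    p3u = pos it3 ix3 (OtherTwo.u∈T o3) (OtherTwo.adj-u o3)
    p3v = pos it3 ix3 (OtherTwo.v∈T o3) (OtherTwo.adj-v o3)
    toT3 : (w ≡ y) ⊎ (w ≡ z) → InTri G w T3
    toT3 h with p3u | p3v | h
    ... | inj₁ refl | _ | inj₁ refl = OtherTwo.u∈T o3
    ... | inj₂ refl | _ | inj₂ refl = OtherTwo.u∈T o3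
    ... | _ | inj₁ refl | inj₁ refl = OtherTwo.v∈T o3
    ... | _ | inj₂ refl | inj₂ refl = OtherTwo.v∈T o3
    ... | inj₁ refl | inj₁ refl | _ = ⊥-elim (OtherTwo.u≢v o3 refl)
    ... | inj₂ refl | inj₂ refl | _ = ⊥-elim (OtherTwo.u≢v o3 refl)
    go : (w ≡ x) ⊎ (w ≡ OtherTwo.u o1) ⊎ (w ≡ OtherTwo.v o1) → InTri G w T3
    go (inj₁ refl) = ix3
    go (inj₂ (inj₁ refl)) = toT3 (pos it1 ix1 (OtherTwo.u∈T o1) (OtherTwo.adj-u o1))
    go (inj₂ (inj₂ refl)) = toT3 (pos it1 ix1 (OtherTwo.v∈T o1) (OtherTwo.adj-v o1))

  triangle-unique : ∀ {T1 T3 x} → IsTriangle G T1 → IsTriangle G T3 → InTri G x T1 → InTri G x T3 → T1 ≡ T3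
  triangle-unique it1 it3 i1 i3 = triangle-ext it1 it3 (triangle-⊆ it1 it3 i1 i3) (triangle-⊆ it3 it1 i3 i1)

module Paths (G : Graph) (ℓ : ℕ → Label) (nlL : LooplessEdges G) (lc : ∀ x → Invariant.Cond G ℓ x) where
  open Invariant G ℓ
  open Structure G ℓ nlL lc
  open Triangles G ℓ nlL lc

  IsLink : V G → Set
  IsLink w = Σ ℕ λ o → Σ ℕ λ d → Σ ℕ λ m → Σ ℕ λ r → L w ≡ link o d m r

  link-not-on-triangle : ∀ {w} → IsLink w → ¬ OnSomeTriangle G w
  link-not-on-triangle (o , d , m , r , e) (T , it , iw) with triangle-label it iw
  ... | _ , _ , e′ = label-clash e e′ (λ ())

  NearerChild : ℕ → ℕ → ℕ → V G → Set
  NearerChild o d m w = (Σ ℕ λ m′ → Σ ℕ λ r′ → (L w ≡ link o d m′ r′) × (m′ < m)) ⊎ (L w ≡ tri (suc d) (up o))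

  nearerChild-≢ : ∀ {o d m r u w} → L u ≡ link o d m r → NearerChild o d m w → u ≢ w
  nearerChild-≢ lu (inj₁ (m′ , r′ , e , lt)) refl = <-irrefl (sym (cong linkBelow (trans (sym lu) e))) lt
  nearerChild-≢ lu (inj₂ e) refl = label-clash lu e (λ ())

  nearerChild-weaken : ∀ {o d m m′ w} → m ≤ m′ → NearerChild o d m w → NearerChild o d m′ w
  nearerChild-weaken le (inj₁ (a , b , e , lt)) = inj₁ (a , b , e , <-≤-trans lt le)
  nearerChild-weaken le (inj₂ e) = inj₂ e

  record PathDown (u : V G) (o d m : ℕ) : Set where
    field
      inner : List (V G)
      end : V G
      end-label : L end ≡ tri (suc d) (up o)
      linked : Linked (Adj G) (u ∷ inner ++ (end ∷ []))
      unique : Unique (u ∷ inner ++ (end ∷ []))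
      nearer : All (NearerChild o d (suc m)) (u ∷ inner ++ (end ∷ []))
      inner-links : All IsLink (u ∷ inner)
      inner-length : length inner ≡ m

  pathDown : ∀ m {o d r u} → L u ≡ link o d m r → PathDown u o d m
  pathDown zero {o} {d} {r} {u} lu = go (linkView lu)
    where
    go : LinkView u o d zero r → PathDown u o d zero
    go ls = record { inner = [] ; end = LinkView.below ls ; end-label = LinkView.below-label ls ; linked = LinkView.below-adj ls ∷ [-] ;
      unique = (≢-by-label lu (LinkView.below-label ls) (λ ()) ∷ []) ∷ [] ∷ [] ;
      nearer = inj₁ (zero , r , lu , s≤s z≤n) ∷ inj₂ (LinkView.below-label ls) ∷ [] ;
      inner-links = (o , d , zero , r , lu) ∷ [] ; inner-length = refl }
  pathDown (suc m) {o} {d} {r} {u} lu = go (linkView lu)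
    where
    go : LinkView u o d (suc m) r → PathDown u o d (suc m)
    go ls = record { inner = LinkView.below ls ∷ PathDown.inner W ; end = PathDown.end W ; end-label = PathDown.end-label W ;
      linked = LinkView.below-adj ls ∷ PathDown.linked W ;
      unique = All.map (λ {w} lw → nearerChild-≢ lu lw) (PathDown.nearer W) ∷ PathDown.unique W ;
      nearer = inj₁ (suc m , r , lu , ≤-refl) ∷ All.map (nearerChild-weaken (n≤1+n _)) (PathDown.nearer W) ;
      inner-links = (o , d , suc m , r , lu) ∷ PathDown.inner-links W ; inner-length = cong suc (PathDown.inner-length W) }
      where W = pathDown m (LinkView.below-label ls)

  NearerParent : ℕ → ℕ → ℕ → V G → Set
  NearerParent o d r w = (Σ ℕ λ m′ → Σ ℕ λ r′ → (L w ≡ link o d m′ r′) × (r′ < r)) ⊎ ((L w ≡ tri d down) × (toℕ w ≡ o))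

  nearerParent-≢ : ∀ {o d m r u w} → L u ≡ link o d m r → NearerParent o d r w → u ≢ w
  nearerParent-≢ lu (inj₁ (m′ , r′ , e , lt)) refl = <-irrefl (sym (cong linkAbove (trans (sym lu) e))) lt
  nearerParent-≢ lu (inj₂ (e , _)) refl = label-clash lu e (λ ())

  nearerParent-weaken : ∀ {o d r r′ w} → r ≤ r′ → NearerParent o d r w → NearerParent o d r′ w
  nearerParent-weaken le (inj₁ (a , b , e , lt)) = inj₁ (a , b , e , <-≤-trans lt le)
  nearerParent-weaken le (inj₂ e) = inj₂ e

  record PathUp (u : V G) (o d r : ℕ) : Set where
    field
      inner : List (V G)
      end : V G
      end-label : L end ≡ tri d down
      end-index : toℕ end ≡ o
      linked : Linked (Adj G) (u ∷ inner ++ (end ∷ []))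
      unique : Unique (u ∷ inner ++ (end ∷ []))
      nearer : All (NearerParent o d (suc r)) (u ∷ inner ++ (end ∷ []))
      inner-links : All IsLink (u ∷ inner)
      inner-length : length inner ≡ r

  pathUp : ∀ r {o d m u} → L u ≡ link o d m r → PathUp u o d r
  pathUp zero {o} {d} {m} {u} lu = go (linkView lu)
    where
    go : LinkView u o d m zero → PathUp u o d zero
    go ls = record { inner = [] ; end = LinkView.above ls ; end-label = proj₁ (LinkView.above-label ls) ; end-index = proj₂ (LinkView.above-label ls) ; linked = LinkView.above-adj ls ∷ [-] ;
      unique = (≢-by-label lu (proj₁ (LinkView.above-label ls)) (λ ()) ∷ []) ∷ [] ∷ [] ;
      nearer = inj₁ (m , zero , lu , s≤s z≤n) ∷ inj₂ (LinkView.above-label ls) ∷ [] ;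
      inner-links = (o , d , m , zero , lu) ∷ [] ; inner-length = refl }
  pathUp (suc r) {o} {d} {m} {u} lu = go (linkView lu)
    where
    go : LinkView u o d m (suc r) → PathUp u o d (suc r)
    go ls = record { inner = LinkView.above ls ∷ PathUp.inner W ; end = PathUp.end W ; end-label = PathUp.end-label W ; end-index = PathUp.end-index W ;
      linked = LinkView.above-adj ls ∷ PathUp.linked W ;
      unique = All.map (λ {w} lw → nearerParent-≢ lu lw) (PathUp.nearer W) ∷ PathUp.unique W ;
      nearer = inj₁ (m , suc r , lu , ≤-refl) ∷ All.map (nearerParent-weaken (n≤1+n _)) (PathUp.nearer W) ;
      inner-links = (o , d , m , suc r , lu) ∷ PathUp.inner-links W ; inner-length = cong suc (PathUp.inner-length W) }
      where W = pathUp r (LinkView.above-label ls)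

  AdjacentVia : Tri G → (V G → Set) → Set
  AdjacentVia T P = Σ (Tri G) λ T′ → IsTriangle G T′ × TriAdj G T T′ × Σ (V G) λ y → InTri G y T′ × P y

  adjacent-via : ∀ {T x d br mid y dy bry} → IsTriangle G T → InTri G x T → L x ≡ tri d br → L y ≡ tri dy bry → dy ≢ d →
    IsPath G (x ∷ mid ++ (y ∷ [])) → All (λ m → ¬ OnSomeTriangle G m) mid → (Σ ℕ λ k → length mid ≡ 2 * k) →
    Σ (Tri G) λ T′ → IsTriangle G T′ × TriAdj G T T′ × InTri G y T′
  adjacent-via {T} {x} {d} {br} {mid} {y} {dy} it ix lx ly ndy ip nm par with triangleView ly
  ... | ts with sortTriangle nl (TriangleView.y≢z ts) (TriangleView.adj-y ts) (TriangleView.adj-yz ts) (TriangleView.adj-z ts)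
  ...   | T′ , it′ , iy , _ , _ = T′ , it′ , (neq , x , mid , y , ix , iy , ip , nm , par) , iy
    where
    neq : T ≢ T′
    neq refl with triangle-mate it ix iy (≢-by-label lx ly (λ q → ndy (sym (cong depth q))))
    ... | d0 , br0 , lx′ , (br′ , ly′ , _) = ndy (trans (cong depth (trans (sym ly) ly′)) (sym (cong depth (trans (sym lx) lx′))))

  child-triangle : ∀ {T x d} → IsTriangle G T → InTri G x T → L x ≡ tri d down →
    AdjacentVia T (λ y → L y ≡ tri (suc d) (up (toℕ x)))
  child-triangle {T} {x} {d} it ix lx = go (triView lx)
    where
    go : BranchedView x d down → AdjacentVia T (λ y → L y ≡ tri (suc d) (up (toℕ x)))
    go tb with BranchedView.branch-start tb
    ... | inj₂ lp with adjacent-via {mid = []} it ix lx lp (λ q → n≢1+n d (sym q))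
          ((((≢-by-label lx lp (λ ())) ∷ []) ∷ [] ∷ []) , (BranchedView.branch-adj tb ∷ [-])) [] (0 , refl)
    ...   | T′ , it′ , ta , iy = T′ , it′ , ta , BranchedView.branch tb , iy , lp
    go tb | inj₁ (m , lp , od) with pathDown m lp
    ... | W with adjacent-via {mid = BranchedView.branch tb ∷ PathDown.inner W} it ix lx (PathDown.end-label W) (λ q → n≢1+n d (sym q))
          ((All.map (λ {w} lw → ne-low′ lw) (PathDown.nearer W) ∷ PathDown.unique W) , (BranchedView.branch-adj tb ∷ PathDown.linked W))
          (All.map link-not-on-triangle (PathDown.inner-links W)) (subst (λ q → Σ ℕ λ k → q ≡ 2 * k) (cong suc (sym (PathDown.inner-length W))) (oddHalf m od))
      where
      ne-low′ : ∀ {w} → NearerChild (toℕ x) d (suc m) w → x ≢ w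
      ne-low′ (inj₁ (_ , _ , e , _)) = ≢-by-label lx e (λ ())
      ne-low′ (inj₂ e) = ≢-by-label lx e (λ ())
    ...   | T′ , it′ , ta , iy = T′ , it′ , ta , PathDown.end W , iy , PathDown.end-label W

  parent-triangle : ∀ {T x d o} → IsTriangle G T → InTri G x T → L x ≡ tri d (up o) →
    AdjacentVia T (λ y → Σ ℕ λ d′ → (d ≡ suc d′) × (L y ≡ tri d′ down))
  parent-triangle {T} {x} {d} {o} it ix lx = go (triView lx)
    where
    go : BranchedView x d (up o) → AdjacentVia T (λ y → Σ ℕ λ d′ → (d ≡ suc d′) × (L y ≡ tri d′ down))
    go tb with BranchedView.branch-start tb
    ... | d′ , refl , inj₂ (lp , tp) with adjacent-via {mid = []} it ix lx lp (λ q → n≢1+n d′ q)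
          ((((≢-by-label lx lp (λ ())) ∷ []) ∷ [] ∷ []) , (BranchedView.branch-adj tb ∷ [-])) [] (0 , refl)
    ...   | T′ , it′ , ta , iy = T′ , it′ , ta , BranchedView.branch tb , iy , d′ , refl , lp
    go tb | d′ , refl , inj₁ (r , lp , od) with pathUp r lp
    ... | W with adjacent-via {mid = BranchedView.branch tb ∷ PathUp.inner W} it ix lx (PathUp.end-label W) (λ q → n≢1+n d′ q)
          ((All.map (λ {w} lw → ne-low′ lw) (PathUp.nearer W) ∷ PathUp.unique W) , (BranchedView.branch-adj tb ∷ PathUp.linked W))
          (All.map link-not-on-triangle (PathUp.inner-links W)) (subst (λ q → Σ ℕ λ k → q ≡ 2 * k) (cong suc (sym (PathUp.inner-length W))) (oddHalf r od))
      where
      ne-low′ : ∀ {w} → NearerParent o d′ (suc r) w → x ≢ w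
      ne-low′ (inj₁ (_ , _ , e , _)) = ≢-by-label lx e (λ ())
      ne-low′ (inj₂ (e , _)) = ≢-by-label lx e (λ ())
    ...   | T′ , it′ , ta , iy = T′ , it′ , ta , PathUp.end W , iy , d′ , refl , PathUp.end-label W

  OddBranch : Branch → Set
  OddBranch down = ⊤
  OddBranch (up _) = ⊤
  OddBranch _ = ⊥

  two-up : ∀ {T x1 x2 d o1 o2} → IsTriangle G T → InTri G x1 T → InTri G x2 T → x1 ≢ x2 →
    L x1 ≡ tri d (up o1) → L x2 ≡ tri d (up o2) → ⊥
  two-up it ix1 ix2 ne lx1 lx2 with triangle-mate it ix1 ix2 ne
  ... | d0 , br0 , e1 , (br′ , e2 , nu) with trans (sym lx1) e1 | trans (sym lx2) e2
  ...   | refl | refl = nu tt tt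

  up-and-down : ∀ {T x1 x2 d o1} → IsTriangle G T → Pendant G T → InTri G x1 T → InTri G x2 T →
    L x1 ≡ tri d (up o1) → L x2 ≡ tri d down → ⊥
  up-and-down {T} {x1} {x2} {d} it (T′ , _ , _ , uq) ix1 ix2 lx1 lx2 with parent-triangle it ix1 lx1 | child-triangle it ix2 lx2
  ... | T1 , it1 , ta1 , y1 , iy1 , d′ , refl , ly1 | T2 , it2 , ta2 , y2 , iy2 , ly2 = go same
    where
    same : T1 ≡ T2
    same = trans (uq T1 it1 ta1) (sym (uq T2 it2 ta2))
    go : T1 ≡ T2 → ⊥
    go refl with triangle-mate it1 iy1 iy2 (≢-by-label ly1 ly2 (λ ()))
    ... | d0 , br0 , e1 , (br′ , e2 , _) =
      n≢2+n d′ (trans (cong depth (trans (sym ly1) e1)) (sym (cong depth (trans (sym ly2) e2))))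

  two-down : ∀ {T x1 x2 d} → IsTriangle G T → Pendant G T → InTri G x1 T → InTri G x2 T → x1 ≢ x2 →
    L x1 ≡ tri d down → L x2 ≡ tri d down → ⊥
  two-down {T} {x1} {x2} {d} it (T′ , _ , _ , uq) ix1 ix2 ne lx1 lx2 with child-triangle it ix1 lx1 | child-triangle it ix2 lx2
  ... | T1 , it1 , ta1 , y1 , iy1 , ly1 | T2 , it2 , ta2 , y2 , iy2 , ly2 = go same
    where
    same : T1 ≡ T2
    same = trans (uq T1 it1 ta1) (sym (uq T2 it2 ta2))
    upId : Label → ℕ
    upId (tri _ (up o)) = o
    upId _ = 0
    go : T1 ≡ T2 → ⊥
    go refl with y1 ≟ y2
    ... | yes refl = ne (toℕ-injective (cong upId (trans (sym ly1) ly2)))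
    ... | no yne with triangle-mate it1 iy1 iy2 yne
    ...   | d0 , br0 , e1 , (br′ , e2 , nu) with trans (sym ly1) e1 | trans (sym ly2) e2
    ...     | refl | refl = nu tt tt

  at-most-one-odd-branch : ∀ {T x1 x2 d b1 b2} → IsTriangle G T → Pendant G T → InTri G x1 T → InTri G x2 T → x1 ≢ x2 →
    L x1 ≡ tri d b1 → L x2 ≡ tri d b2 → OddBranch b1 → OddBranch b2 → ⊥
  at-most-one-odd-branch {b1 = down} {down} it pd ix1 ix2 ne l1 l2 _ _ = two-down it pd ix1 ix2 ne l1 l2
  at-most-one-odd-branch {b1 = down} {up _} it pd ix1 ix2 ne l1 l2 _ _ = up-and-down it pd ix2 ix1 l2 l1
  at-most-one-odd-branch {b1 = up _} {down} it pd ix1 ix2 ne l1 l2 _ _ = up-and-down it pd ix1 ix2 l1 l2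
  at-most-one-odd-branch {b1 = up _} {up _} it pd ix1 ix2 ne l1 l2 _ _ = two-up it ix1 ix2 ne l1 l2

-- Every graph of 𝔗 is labelled

setL : (ℕ → Label) → ℕ → Label → (ℕ → Label)
setL ℓ k X j = if does (j ℕ.≟ k) then X else ℓ j

setL-hit : ∀ ℓ k X → setL ℓ k X k ≡ X
setL-hit ℓ k X rewrite dec-true (k ℕ.≟ k) refl = refl

setL-miss : ∀ ℓ k X j → j ≢ k → setL ℓ k X j ≡ ℓ j
setL-miss ℓ k X j j≢k rewrite dec-false (j ℕ.≟ k) j≢k = refl

fromℕ-or-inject₁ : ∀ {n} (x : Fin (suc n)) → (x ≡ fromℕ n) ⊎ (Σ (Fin n) λ y → x ≡ inject₁ y)
fromℕ-or-inject₁ {zero} zero = inj₁ refl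
fromℕ-or-inject₁ {suc n} zero = inj₂ (zero , refl)
fromℕ-or-inject₁ {suc n} (suc x) with fromℕ-or-inject₁ x
... | inj₁ refl = inj₁ refl
... | inj₂ (y , refl) = inj₂ (suc y , refl)

toℕ≢bound : ∀ {m} (x : Fin m) → toℕ x ≢ m
toℕ≢bound x e = <-irrefl e (toℕ<n x)

module AddPendantVertex (G : Graph) (u : V G) where
  G′ : Graph
  G′ = proj₁ (pendantVertex G u)
  ν : V G′
  ν = fromℕ (n G)
  ι : V G → V G′
  ι = inject₁

  open Extension {G} {G′} ι inject₁-injective ((ι u , ν) ∷ []) refl public

  adj-uν : Adj G′ (ι u) ν
  adj-uν = adj-new (here refl)

  ι≢ν : ∀ a → ι a ≢ ν
  ι≢ν a e = fromℕ≢inject₁ (sym e)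

  deg-old : ∀ x → x ≢ u → deg G′ (ι x) ≡ deg G x
  deg-old x x≢u = trans (deg-ι x) (trans (cong (deg G x +_) new-edge) (+-identityʳ _))
    where
    new-edge : degL (ι x) ((ι u , ν) ∷ []) ≡ 0
    new-edge rewrite does-≟-injective ι inject₁-injective u x | dec-false (u ≟ x) (x≢u ∘ sym)
      | dec-false (ν ≟ ι x) (ι≢ν x ∘ sym) = refl

  deg-u : deg G′ (ι u) ≡ suc (deg G u)
  deg-u = trans (deg-ι u) (trans (cong (deg G u +_) new-edge) (+-comm (deg G u) 1))
    where
    new-edge : degL (ι u) ((ι u , ν) ∷ []) ≡ 1
    new-edge rewrite does-≟-injective ι inject₁-injective u u | dec-true (u ≟ u) refl = refl

  deg-ν : deg G′ ν ≡ 1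
  deg-ν = trans (deg-fresh ν ι≢ν) new-edge
    where
    new-edge : degL ν ((ι u , ν) ∷ []) ≡ 1
    new-edge rewrite dec-false (ι u ≟ ν) (ι≢ν u) | dec-true (ν ≟ ν) refl = refl

  looplessEdges′ : LooplessEdges G → LooplessEdges G′
  looplessEdges′ nl = looplessEdges nl (ι≢ν u ∷ [])

  module Relabel (ℓ : ℕ → Label) (Xu Xn : Label) (u-relabels : Relabels (ℓ (toℕ u)) Xu) where
    ℓ′ : ℕ → Label
    ℓ′ = setL (setL ℓ (toℕ u) Xu) (n G) Xn

    ℓ′-ν : ℓ′ (toℕ ν) ≡ Xn
    ℓ′-ν rewrite toℕ-fromℕ (n G) = setL-hit (setL ℓ (toℕ u) Xu) (n G) Xn

    ℓ′-u : ℓ′ (toℕ u) ≡ Xu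
    ℓ′-u = trans (setL-miss (setL ℓ (toℕ u) Xu) (n G) Xn (toℕ u) (toℕ≢bound u)) (setL-hit ℓ (toℕ u) Xu)

    ℓ′-ιu : ℓ′ (toℕ (ι u)) ≡ Xu
    ℓ′-ιu rewrite toℕ-inject₁ u = ℓ′-u

    ℓ′-old : ∀ x → x ≢ u → ℓ′ (toℕ x) ≡ ℓ (toℕ x)
    ℓ′-old x x≢u = trans (setL-miss (setL ℓ (toℕ u) Xu) (n G) Xn (toℕ x) (toℕ≢bound x))
      (setL-miss ℓ (toℕ u) Xu (toℕ x) (x≢u ∘ toℕ-injective))

    relabels : ∀ (a : V G) → Relabels (ℓ (toℕ a)) (ℓ′ (toℕ a))
    relabels a with a ≟ u
    ... | yes refl = subst (Relabels (ℓ (toℕ u))) (sym ℓ′-u) u-relabels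
    ... | no a≢u = inj₁ (ℓ′-old a a≢u)

    open Transport G G′ ℓ ℓ′ ι toℕ-inject₁ adj-ι relabels public

    cond-except-ν : (∀ x → x ≢ u → Invariant.Cond G ℓ x) → Invariant.Cond G′ ℓ′ (ι u) →
      ∀ x → x ≢ ν → Invariant.Cond G′ ℓ′ x
    cond-except-ν old cu x x≢ν with fromℕ-or-inject₁ x
    ... | inj₁ refl = ⊥-elim (x≢ν refl)
    ... | inj₂ (y , refl) with y ≟ u
    ...   | yes refl = cu
    ...   | no y≢u = keepCond y (deg-old y y≢u) (ℓ′-old y y≢u) (old y y≢u)

    cond-all : (∀ x → x ≢ u → Invariant.Cond G ℓ x) → Invariant.Cond G′ ℓ′ (ι u) → Invariant.Cond G′ ℓ′ ν →
      ∀ x → Invariant.Cond G′ ℓ′ x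
    cond-all old cu cν x with x ≟ ν
    ... | yes refl = cν
    ... | no x≢ν = cond-except-ν old cu x x≢ν

module AddTriangle (G : Graph) (w : V G) where
  G′ : Graph
  G′ = attachTriangle G w
  ι : V G → V G′
  ι a = inject₁ (inject₁ a)
  t₁ t₂ : V G′
  t₁ = inject₁ (fromℕ (n G))
  t₂ = fromℕ (suc (n G))
  new : List (V G′ × V G′)
  new = (ι w , t₁) ∷ (ι w , t₂) ∷ (t₁ , t₂) ∷ []

  ι-injective : ∀ {a b} → ι a ≡ ι b → a ≡ b
  ι-injective = inject₁-injective ∘ inject₁-injective

  open Extension {G} {G′} ι ι-injective new refl public

  ι≢t₁ : ∀ a → ι a ≢ t₁
  ι≢t₁ a e = fromℕ≢inject₁ (sym (inject₁-injective e))
  ι≢t₂ : ∀ a → ι a ≢ t₂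
  ι≢t₂ a e = fromℕ≢inject₁ (sym e)
  t₁≢t₂ : t₁ ≢ t₂
  t₁≢t₂ e = fromℕ≢inject₁ (sym e)

  toℕ-ι : ∀ a → toℕ (ι a) ≡ toℕ a
  toℕ-ι a = trans (toℕ-inject₁ (inject₁ a)) (toℕ-inject₁ a)
  toℕ-t₁ : toℕ t₁ ≡ n G
  toℕ-t₁ = trans (toℕ-inject₁ (fromℕ (n G))) (toℕ-fromℕ (n G))
  toℕ-t₂ : toℕ t₂ ≡ suc (n G)
  toℕ-t₂ = toℕ-fromℕ (suc (n G))

  adj-wt₁ : Adj G′ (ι w) t₁
  adj-wt₁ = adj-new (here refl)
  adj-wt₂ : Adj G′ (ι w) t₂
  adj-wt₂ = adj-new (there (here refl))
  adj-t₁t₂ : Adj G′ t₁ t₂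
  adj-t₁t₂ = adj-new (there (there (here refl)))

  deg-old : ∀ x → x ≢ w → deg G′ (ι x) ≡ deg G x
  deg-old x x≢w = trans (deg-ι x) (trans (cong (deg G x +_) new-edges) (+-identityʳ _))
    where
    new-edges : degL (ι x) new ≡ 0
    new-edges rewrite does-≟-injective ι ι-injective w x | dec-false (w ≟ x) (x≢w ∘ sym)
      | dec-false (t₁ ≟ ι x) (ι≢t₁ x ∘ sym) | dec-false (t₂ ≟ ι x) (ι≢t₂ x ∘ sym) = refl
  deg-w : deg G′ (ι w) ≡ deg G w + 2
  deg-w = trans (deg-ι w) (cong (deg G w +_) new-edges)
    where
    new-edges : degL (ι w) new ≡ 2
    new-edges rewrite does-≟-injective ι ι-injective w w | dec-true (w ≟ w) refl
      | dec-false (t₁ ≟ ι w) (ι≢t₁ w ∘ sym) | dec-false (t₂ ≟ ι w) (ι≢t₂ w ∘ sym) = refl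
  deg-t₁ : deg G′ t₁ ≡ 2
  deg-t₁ = trans (deg-fresh t₁ ι≢t₁) new-edges
    where
    new-edges : degL t₁ new ≡ 2
    new-edges rewrite dec-false (ι w ≟ t₁) (ι≢t₁ w) | dec-true (t₁ ≟ t₁) refl | dec-false (t₂ ≟ t₁) (t₁≢t₂ ∘ sym) = refl
  deg-t₂ : deg G′ t₂ ≡ 2
  deg-t₂ = trans (deg-fresh t₂ ι≢t₂) new-edges
    where
    new-edges : degL t₂ new ≡ 2
    new-edges rewrite dec-false (ι w ≟ t₂) (ι≢t₂ w) | dec-true (t₂ ≟ t₂) refl | dec-false (t₁ ≟ t₂) t₁≢t₂ = refl

  looplessEdges′ : LooplessEdges G → LooplessEdges G′
  looplessEdges′ nl = looplessEdges nl (ι≢t₁ w ∷ ι≢t₂ w ∷ t₁≢t₂ ∷ [])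

  vertices : (x : V G′) → (x ≡ t₂) ⊎ (x ≡ t₁) ⊎ (Σ (V G) λ y → x ≡ ι y)
  vertices x with fromℕ-or-inject₁ x
  ... | inj₁ refl = inj₁ refl
  ... | inj₂ (y , refl) with fromℕ-or-inject₁ y
  ...   | inj₁ refl = inj₂ (inj₁ refl)
  ...   | inj₂ (z , refl) = inj₂ (inj₂ (z , refl))

-- G is labelled except at the tip w of a growing path, which has degree one; the tip
-- carries its final label but only its neighbour towards the triangle is known.
LabelledExcept : (G : Graph) → (ℕ → Label) → V G → Set
LabelledExcept G ℓ w = LooplessEdges G × (∀ x → x ≢ w → Invariant.Cond G ℓ x) × (deg G w ≡ 1)

TriangleTip : (G : Graph) → (ℕ → Label) → V G → ℕ → ℕ → Set
TriangleTip G ℓ w o d = LabelledExcept G ℓ w × (Invariant.L G ℓ w ≡ tri (suc d) (up o)) ×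
  Σ (V G) λ p → Adj G w p × Invariant.BranchStart G ℓ (suc d) (up o) w p

PendantTip : (G : Graph) → (ℕ → Label) → V G → ℕ → ℕ → Set
PendantTip G ℓ w o j = LabelledExcept G ℓ w × (Invariant.L G ℓ w ≡ pend o (suc j)) ×
  Σ (V G) λ w₂ → Adj G w w₂ × Invariant.PendUp G ℓ o j w₂

LinkTip : (G : Graph) → (ℕ → Label) → V G → ℕ → ℕ → ℕ → ℕ → Set
LinkTip G ℓ w o d m r = LabelledExcept G ℓ w × (Invariant.L G ℓ w ≡ link o d m r) × Odd (m + r) ×
  Σ (V G) λ w₂ → Adj G w w₂ × Invariant.LinkUp G ℓ o d m r w₂

closeTriangle : ∀ G ℓ w o d → TriangleTip G ℓ w o d → Labelled (attachTriangle G w)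
closeTriangle G ℓ w o d ((nl , old , dw) , lw , p , wp , bs) = looplessEdges′ nl , ℓ″ , cond
  where
  open AddTriangle G w
  X = tri (suc d) none
  ℓ″ : ℕ → Label
  ℓ″ = setL (setL ℓ (n G) X) (suc (n G)) X
  ℓ″-old : ∀ (a : V G) → ℓ″ (toℕ a) ≡ ℓ (toℕ a)
  ℓ″-old a = trans (setL-miss (setL ℓ (n G) X) (suc (n G)) X (toℕ a) (<⇒≢ (≤-trans (toℕ<n a) (n≤1+n _))))
                   (setL-miss ℓ (n G) X (toℕ a) (toℕ≢bound a))
  ℓ″-t₁ : ℓ″ (toℕ t₁) ≡ X
  ℓ″-t₁ = trans (cong ℓ″ toℕ-t₁) (trans (setL-miss (setL ℓ (n G) X) (suc (n G)) X (n G) (n≢1+n (n G))) (setL-hit ℓ (n G) X))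
  ℓ″-t₂ : ℓ″ (toℕ t₂) ≡ X
  ℓ″-t₂ = trans (cong ℓ″ toℕ-t₂) (setL-hit (setL ℓ (n G) X) (suc (n G)) X)
  ℓ″-w : ℓ″ (toℕ (ι w)) ≡ tri (suc d) (up o)
  ℓ″-w = trans (cong ℓ″ (toℕ-ι w)) (trans (ℓ″-old w) lw)
  open Transport G G′ ℓ ℓ″ ι toℕ-ι adj-ι (λ a → inj₁ (ℓ″-old a))
  cond : ∀ x → Invariant.Cond G′ ℓ″ x
  cond x with vertices x
  ... | inj₁ refl = subst (Invariant.CondAt G′ ℓ″ t₂) (sym ℓ″-t₂)
    (ι w , t₁ , ι≢t₁ w , adj-sym adj-wt₂ , adj-sym adj-t₁t₂ , adj-wt₁ , (up o , ℓ″-w , λ ()) , (none , ℓ″-t₁ , λ ()) , deg-t₂)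
  ... | inj₂ (inj₁ refl) = subst (Invariant.CondAt G′ ℓ″ t₁) (sym ℓ″-t₁)
    (ι w , t₂ , ι≢t₂ w , adj-sym adj-wt₁ , adj-t₁t₂ , adj-wt₂ , (up o , ℓ″-w , λ ()) , (none , ℓ″-t₂ , λ ()) , deg-t₁)
  ... | inj₂ (inj₂ (y , refl)) with y ≟ w
  ...   | yes refl = subst (Invariant.CondAt G′ ℓ″ (ι w)) (sym ℓ″-w)
    (t₁ , t₂ , t₁≢t₂ , adj-wt₁ , adj-wt₂ , adj-t₁t₂ , (none , ℓ″-t₁ , λ _ ()) , (none , ℓ″-t₂ , λ _ ()) ,
     trans deg-w (cong (_+ 2) dw) , ι p , adj-ι wp , keepBranchStart {suc d} {up o} {w} {p} bs)
  ...   | no y≢w = keepCond y (deg-old y y≢w) (ℓ″-old y) (old y y≢w)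

extendPendant : ∀ j G ℓ w o → PendantTip G ℓ w o j → Labelled (proj₁ (attachPath G w (suc j)))
extendPendant zero G ℓ w o ((nl , old , dw) , lw , w₂ , a₂ , u₂) =
  looplessEdges′ nl , ℓ′ , cond-all old cw (subst (Invariant.CondAt G′ ℓ′ ν) (sym ℓ′-ν) (deg-ν , ι w , adj-sym adj-uν , ℓ′-ιu))
  where
  open AddPendantVertex G w
  open Relabel ℓ (pend o 1) (pend o 0) (inj₁ (sym lw))
  cw : Invariant.Cond G′ ℓ′ (ι w)
  cw = subst (Invariant.CondAt G′ ℓ′ (ι w)) (sym ℓ′-ιu)
    (trans deg-u (cong suc dw) , (ν , adj-uν , ℓ′-ν) , (ι w₂ , adj-ι a₂ , keepPendUp u₂))
extendPendant (suc j) G ℓ w o ((nl , old , dw) , lw , w₂ , a₂ , u₂) =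
  extendPendant j G′ ℓ′ ν o ((looplessEdges′ nl , cond-except-ν old cw , deg-ν) , ℓ′-ν , ι w , adj-sym adj-uν , inj₁ ℓ′-ιu)
  where
  open AddPendantVertex G w
  open Relabel ℓ (pend o (suc (suc j))) (pend o (suc j)) (inj₁ (sym lw))
  cw : Invariant.Cond G′ ℓ′ (ι w)
  cw = subst (Invariant.CondAt G′ ℓ′ (ι w)) (sym ℓ′-ιu)
    (trans deg-u (cong suc dw) , (ν , adj-uν , ℓ′-ν) , (ι w₂ , adj-ι a₂ , keepPendUp u₂))

extendLink : ∀ m G ℓ w o d r → LinkTip G ℓ w o d m r →
  Labelled (attachTriangle (proj₁ (attachPath G w (suc m))) (proj₂ (attachPath G w (suc m))))
extendLink zero G ℓ w o d r ((nl , old , dw) , lw , odd , w₂ , a₂ , u₂) =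
  closeTriangle G′ ℓ′ ν o d ((looplessEdges′ nl , cond-except-ν old cw , deg-ν) , ℓ′-ν , ι w , adj-sym adj-uν ,
    (d , refl , inj₁ (r , ℓ′-ιu , odd)))
  where
  open AddPendantVertex G w
  open Relabel ℓ (link o d zero r) (tri (suc d) (up o)) (inj₁ (sym lw))
  cw : Invariant.Cond G′ ℓ′ (ι w)
  cw = subst (Invariant.CondAt G′ ℓ′ (ι w)) (sym ℓ′-ιu)
    (trans deg-u (cong suc dw) , (ν , adj-uν , ℓ′-ν) , (ι w₂ , adj-ι a₂ , keepLinkUp {o} {d} {zero} {r} {w₂} u₂))
extendLink (suc m) G ℓ w o d r ((nl , old , dw) , lw , odd , w₂ , a₂ , u₂) =
  extendLink m G′ ℓ′ ν o d (suc r) ((looplessEdges′ nl , cond-except-ν old cw , deg-ν) , ℓ′-ν ,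
    subst Odd (sym (+-suc m r)) odd , ι w , adj-sym adj-uν , ℓ′-ιu)
  where
  open AddPendantVertex G w
  open Relabel ℓ (link o d (suc m) r) (link o d m (suc r)) (inj₁ (sym lw))
  cw : Invariant.Cond G′ ℓ′ (ι w)
  cw = subst (Invariant.CondAt G′ ℓ′ (ι w)) (sym ℓ′-ιu)
    (trans deg-u (cong suc dw) , (ν , adj-uν , ℓ′-ν) , (ι w₂ , adj-ι a₂ , keepLinkUp {o} {d} {suc m} {r} {w₂} u₂))

module Grow (G : Graph) (ℓ : ℕ → Label) (nl : LooplessEdges G) (lc : ∀ x → Invariant.Cond G ℓ x)
  (v : V G) (d : ℕ) (lv : Invariant.L G ℓ v ≡ tri d none) where
  open Structure G ℓ nl lc using (triView; UnbranchedView; TriangleView)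
  view = triView lv
  open TriangleView (UnbranchedView.triangle view)

  module Step (br : Branch) (not-up : ¬ IsUp br) (Xν : Label) where
    open AddPendantVertex G v public
    open Relabel ℓ (tri d br) Xν (inj₂ (d , lv , br , refl , not-up)) public

    cond-old : ∀ x → x ≢ v → Invariant.Cond G ℓ x
    cond-old x _ = lc x

    deg-v : deg G′ (ι v) ≡ 3
    deg-v = trans deg-u (cong suc (UnbranchedView.degree view))

    cond-v : Invariant.BranchCond G′ ℓ′ (ι v) d br → Invariant.Cond G′ ℓ′ (ι v)
    cond-v bc = subst (Invariant.CondAt G′ ℓ′ (ι v)) (sym ℓ′-ιu)
      (ι y , ι z , y≢z ∘ inject₁-injective , adj-ι adj-y , adj-ι adj-z , adj-ι adj-yz , mate mate-y , mate mate-z , bc)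
      where
      mate : ∀ {w} → Invariant.Mate G ℓ d none w → Invariant.Mate G′ ℓ′ d br (ι w)
      mate (br′ , e , _) = keepMate (br′ , e , ⊥-elim ∘ not-up)

  growEven : ∀ k → Labelled (proj₁ (attachPath G v (2 * k)))
  growEven zero = nl , ℓ , lc
  growEven (suc k) = subst (λ L → Labelled (proj₁ (attachPath G v L))) (sym (2*suc k))
    (extendPendant (2 * k) G′ ℓ′ ν (toℕ v)
      ((looplessEdges′ nl , cond-except-ν cond-old cv , deg-ν) , ℓ′-ν , ι v , adj-sym adj-uν , inj₂ (d , ℓ′-ιu , toℕ-inject₁ v)))
    where
    open Step pendant (λ ()) (pend (toℕ v) (suc (2 * k)))
    cv = cond-v (deg-v , ν , adj-uν , suc (2 * k) , trans ℓ′-ν (cong (λ o → pend o (suc (2 * k))) (sym (toℕ-inject₁ v))) , even-2* k)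

  growOdd : ∀ k → let P = attachPath G v (suc (2 * k)) in Labelled (attachTriangle (proj₁ P) (proj₂ P))
  growOdd zero = closeTriangle G′ ℓ′ ν (toℕ v) d
      ((looplessEdges′ nl , cond-except-ν cond-old cv , deg-ν) , ℓ′-ν , ι v , adj-sym adj-uν , (d , refl , inj₂ (ℓ′-ιu , toℕ-inject₁ v)))
    where
    open Step down (λ ()) (tri (suc d) (up (toℕ v)))
    cv = cond-v (deg-v , ν , adj-uν , inj₂ (trans ℓ′-ν (cong (λ o → tri (suc d) (up o)) (sym (toℕ-inject₁ v)))))
  growOdd (suc k) = subst (λ L → let P = attachPath G v (suc L) in Labelled (attachTriangle (proj₁ P) (proj₂ P))) (sym (2*suc k))
    (extendLink (suc (2 * k)) G′ ℓ′ ν (toℕ v) d zero ((looplessEdges′ nl , cond-except-ν cond-old cv , deg-ν) , ℓ′-ν ,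
      subst Odd (sym (+-identityʳ (suc (2 * k)))) (even-2* k) , ι v , adj-sym adj-uν , ℓ′-ιu , toℕ-inject₁ v))
    where
    open Step down (λ ()) (link (toℕ v) d (suc (2 * k)) zero)
    cv = cond-v (deg-v , ν , adj-uν , inj₁ (suc (2 * k) , trans ℓ′-ν (cong (λ o → link o d (suc (2 * k)) zero) (sym (toℕ-inject₁ v))) , even-2* k))

C₃-labelled : Labelled C3
C₃-labelled = ((λ ()) ∷ (λ ()) ∷ (λ ()) ∷ []) , (λ _ → tri 0 none) , cond
  where
  cond : ∀ x → Invariant.Cond C3 (λ _ → tri 0 none) x
  cond zero = suc zero , suc (suc zero) , (λ ()) , inj₁ (here refl) , inj₁ (there (there (here refl))) ,
    inj₁ (there (here refl)) , (none , refl , λ ()) , (none , refl , λ ()) , refl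
  cond (suc zero) = zero , suc (suc zero) , (λ ()) , inj₂ (here refl) , inj₁ (there (here refl)) ,
    inj₁ (there (there (here refl))) , (none , refl , λ ()) , (none , refl , λ ()) , refl
  cond (suc (suc zero)) = zero , suc zero , (λ ()) , inj₂ (there (there (here refl))) , inj₂ (there (here refl)) ,
    inj₁ (here refl) , (none , refl , λ ()) , (none , refl , λ ()) , refl

𝔗-labelled : ∀ {G} → InT G → Labelled G
𝔗-labelled base = C₃-labelled
𝔗-labelled (evenPath {G} t v d2 onT k) with 𝔗-labelled t
... | nl , ℓ , lc with Structure.branchless-triangle-vertex G ℓ nl lc d2 onT
...   | d , lv = Grow.growEven G ℓ nl lc v d lv k
𝔗-labelled (oddPathTriangle {G} t v d2 onT k) with 𝔗-labelled t
... | nl , ℓ , lc with Structure.branchless-triangle-vertex G ℓ nl lc d2 onT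
...   | d , lv = Grow.growOdd G ℓ nl lc v d lv k

-- Colourings forced by local irregularity

forcedDeg : ℕ → ℕ
forcedDeg zero = 1
forcedDeg (suc zero) = 2
forcedDeg (suc (suc n)) = forcedDeg n

forcedDeg-alternates : ∀ j → ((forcedDeg j ≡ 1) × (forcedDeg (suc j) ≡ 2)) ⊎ ((forcedDeg j ≡ 2) × (forcedDeg (suc j) ≡ 1))
forcedDeg-alternates zero = inj₁ (refl , refl)
forcedDeg-alternates (suc zero) = inj₂ (refl , refl)
forcedDeg-alternates (suc (suc j)) = forcedDeg-alternates j

forcedDeg-odd : ∀ j → Odd j → forcedDeg j ≡ 2
forcedDeg-odd zero ()
forcedDeg-odd (suc zero) _ = refl
forcedDeg-odd (suc (suc j)) o = forcedDeg-odd j o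

matches : Bool → Bool → ℕ
matches a c = if does (a ≟ᵇ c) then 1 else 0

path-step : ∀ (cf ce : Bool) k k′ → ((k ≡ 1) × (k′ ≡ 2)) ⊎ ((k ≡ 2) × (k′ ≡ 1)) → ¬ k ≡ matches cf cf + (matches ce cf + 0) →
  matches cf ce + (matches ce ce + 0) ≡ k′
path-step true true _ _ (inj₁ (refl , refl)) h = refl
path-step false false _ _ (inj₁ (refl , refl)) h = refl
path-step true false _ _ (inj₁ (refl , refl)) h = ⊥-elim (h refl)
path-step false true _ _ (inj₁ (refl , refl)) h = ⊥-elim (h refl)
path-step true true _ _ (inj₂ (refl , refl)) h = ⊥-elim (h refl)
path-step false false _ _ (inj₂ (refl , refl)) h = ⊥-elim (h refl)
path-step true false _ _ (inj₂ (refl , refl)) h = refl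
path-step false true _ _ (inj₂ (refl , refl)) h = refl

matches-self : ∀ c → matches c c ≡ 1
matches-self true = refl
matches-self false = refl

∀-Bool? : {P : Bool → Set} → (∀ b → Dec (P b)) → Dec (∀ b → P b)
∀-Bool? P? with P? false | P? true
... | yes pf | yes pt = yes λ { false → pf ; true → pt }
... | no ¬pf | _ = no λ h → ¬pf (h false)
... | _ | no ¬pt = no λ h → ¬pt (h true)

TriangleColours : (cAB cBC cAC cBp cCq cAp dAp : Bool) → Set
TriangleColours cAB cBC cAC cBp cCq cAp dAp =
  wB cBp ≢ 2 → wC cCq ≢ 2 → wA cAB ≢ wB cAB → wB cBC ≢ wC cBC → wA cAC ≢ wC cAC → (dAp ≡ true) × (wA cAp ≡ 4)
  where
  wA wB wC : Bool → ℕ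
  wA c = matches cAB c + matches cAC c + (if does (cAp ≟ᵇ c) then (if dAp then 2 else 1) else 0)
  wB c = matches cAB c + matches cBC c + matches cBp c
  wC c = matches cAC c + matches cBC c + matches cCq c

triangleColours? : ∀ cAB cBC cAC cBp cCq cAp dAp → Dec (TriangleColours cAB cBC cAC cBp cCq cAp dAp)
triangleColours? cAB cBC cAC cBp cCq cAp dAp =
  ¬? (_ ℕ.≟ 2) →-dec (¬? (_ ℕ.≟ 2) →-dec (¬? (_ ℕ.≟ _) →-dec (¬? (_ ℕ.≟ _) →-dec (¬? (_ ℕ.≟ _) →-dec
    ((dAp ≟ᵇ true) ×-dec (_ ℕ.≟ 4))))))

-- decided by evaluation on all 2⁷ cases
triangle-colours : ∀ cAB cBC cAC cBp cCq cAp dAp → TriangleColours cAB cBC cAC cBp cCq cAp dAp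
triangle-colours = toWitness {a? = ∀-Bool? λ a → ∀-Bool? λ b → ∀-Bool? λ c → ∀-Bool? λ d → ∀-Bool? λ e → ∀-Bool? λ f → ∀-Bool? λ g → triangleColours? a b c d e f g} _

module Colouring (G : Graph) (ℓ : ℕ → Label) (nlL : LooplessEdges G) (lc : ∀ x → Invariant.Cond G ℓ x)
  (Ed col : EdgeIx G → Bool) (LI : LIColouring G Ed col) where
  open Invariant G ℓ
  open Structure G ℓ nlL lc

  W : EdgeIx G → Bool → ℕ
  W = weight G Ed col

  CD : Bool → V G → ℕ
  CD = colDeg G Ed col

  irregular : ∀ {e x w} → Joins G e x w → CD (col e) x ≢ CD (col e) w
  irregular = LIColouring⇒irregular G Ed col LI

  undoubled : ∀ {e} c → Ed e ≡ false → W e c ≡ matches (col e) c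
  undoubled {e} c = weight-undoubled G Ed col e c

  colDeg-pendEnd : ∀ {u o} (v : PendEndView u o) c → CD c u ≡ W (edgeOf G (PendEndView.near-adj v)) c + 0
  colDeg-pendEnd v c = colDeg≡weightSum G Ed col nl ([] ∷ []) (PendEndView.near-adj v ∷ []) (sym (PendEndView.degree v)) c

  far≢near : ∀ {u o j} (v : PendView u o j) → PendView.far v ≢ PendView.near v
  far≢near {j = j} v with PendView.near-label v
  ... | inj₁ e = ≢-by-label (PendView.far-label v) e (λ q → n≢2+n j (cong pendPos q))
  ... | inj₂ (_ , e , _) = ≢-by-label (PendView.far-label v) e (λ ())

  colDeg-pend : ∀ {u o j} (v : PendView u o j) c →
    CD c u ≡ W (edgeOf G (PendView.far-adj v)) c + (W (edgeOf G (PendView.near-adj v)) c + 0)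
  colDeg-pend v c = colDeg≡weightSum G Ed col nl ((far≢near v ∷ []) ∷ [] ∷ []) (PendView.far-adj v ∷ PendView.near-adj v ∷ [])
    (sym (PendView.degree v)) c

  OnPendantPath : ℕ → EdgeIx G → Set
  OnPendantPath o f = Σ (V G) λ v → Σ (V G) λ w → Joins G f v w × Σ ℕ λ k → L v ≡ pend o k

  NotFarther : ℕ → ℕ → V G → Set
  NotFarther o zero w = ⊤
  NotFarther o (suc j) w = L w ≢ pend o j

  PathOutcome : ℕ → EdgeIx G → V G → ℕ → Set
  PathOutcome o e u j = (Σ (EdgeIx G) λ f → (Ed f ≡ true) × OnPendantPath o f) ⊎ ((Ed e ≡ false) × (CD (col e) u ≡ forcedDeg j))

  -- If no edge of a pendant path is doubled, local irregularity forces the colour degrees along it: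
  -- the vertex at distance j from the free end has degree forcedDeg j in the colour of its edge e
  -- towards the triangle.
  pendant-path-outcome : ∀ j {u w e o} → L u ≡ pend o j → Joins G e u w → NotFarther o j w → PathOutcome o e u j
  pendant-path-outcome zero {u} {w} {e} {o} lu uw _ with Ed e in doubled?
  ... | true = inj₁ (e , doubled? , u , w , uw , zero , lu)
  ... | false = inj₂ (refl , (begin
    CD (col e) u                                  ≡⟨ colDeg-pendEnd v (col e) ⟩
    W (edgeOf G (PendEndView.near-adj v)) (col e) + 0 ≡⟨ cong (λ i → W i (col e) + 0) (sym e≡) ⟩
    W e (col e) + 0                               ≡⟨ cong (_+ 0) (trans (undoubled (col e) doubled?) (matches-self (col e))) ⟩
    1                                             ∎))
    where
    open ≡-Reasoning
    v = pendEndView lu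
    e≡ : e ≡ edgeOf G (PendEndView.near-adj v)
    e≡ = edge-unique uw (subst (Joins G (edgeOf G (PendEndView.near-adj v)) u) (sym (PendEndView.only v (joins⇒adj G uw)))
      (edgeOf-joins G (PendEndView.near-adj v)))
  pendant-path-outcome (suc j) {u} {w} {e} {o} lu uw not-farther with pendView lu
  ... | v with PendView.only v (joins⇒adj G uw)
  ...   | inj₁ refl = ⊥-elim (not-farther (PendView.far-label v))
  ...   | inj₂ refl with pendant-path-outcome j (PendView.far-label v) (joins-sym G (edgeOf-joins G (PendView.far-adj v))) (u-not-farther j lu)
    where
    u-not-farther : ∀ j → L u ≡ pend o (suc j) → NotFarther o j u
    u-not-farther zero _ = tt
    u-not-farther (suc j) lu q = n≢2+n j (sym (cong pendPos (trans (sym lu) q)))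
  ...     | inj₁ doubled = inj₁ doubled
  ...     | inj₂ (f-undoubled , cd-far) with Ed e in doubled?
  ...       | true = inj₁ (e , doubled? , u , w , uw , suc j , lu)
  ...       | false = inj₂ (refl , trans (cd-u (col e)) (path-step (col f) (col e) (forcedDeg j) (forcedDeg (suc j))
                (forcedDeg-alternates j) (λ h → irregular (joins-sym G (edgeOf-joins G (PendView.far-adj v))) (trans cd-far (trans h (sym (cd-u (col f))))))))
    where
    f = edgeOf G (PendView.far-adj v)
    e≡ : e ≡ edgeOf G (PendView.near-adj v)
    e≡ = edge-unique uw (edgeOf-joins G (PendView.near-adj v))
    cd-u : ∀ c → CD c u ≡ matches (col f) c + (matches (col e) c + 0)
    cd-u c = trans (colDeg-pend v c) (cong₂ (λ a b → a + (b + 0)) (undoubled c f-undoubled)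
      (trans (cong (λ i → W i c) (sym e≡)) (undoubled c doubled?)))

  colDeg-branched : ∀ {x d br a b ba bb} (tb : BranchedView x d br) (xa : Adj G x a) (xb : Adj G x b) →
    L a ≡ tri d ba → L b ≡ tri d bb → a ≢ b →
    ∀ c → CD c x ≡ W (edgeOf G xa) c + W (edgeOf G xb) c + W (edgeOf G (BranchedView.branch-adj tb)) c
  colDeg-branched {x} {d} {br} tb xa xb la lb a≢b c = go (same-depth-neighbour tb xa la) (same-depth-neighbour tb xb lb)
    where
    open TriangleView (BranchedView.triangle tb)
    ey = edgeOf G adj-y
    ez = edgeOf G adj-z
    ep = edgeOf G (BranchedView.branch-adj tb)
    cd : CD c x ≡ W ey c + (W ez c + (W ep c + 0))
    cd = colDeg≡weightSum G Ed col nl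
      ((y≢z ∷ mate≢branch {br = br} label-y (BranchedView.branch-start tb) ∷ []) ∷
       (mate≢branch {br = br} label-z (BranchedView.branch-start tb) ∷ []) ∷ [] ∷ [])
      (adj-y ∷ adj-z ∷ BranchedView.branch-adj tb ∷ []) (sym (BranchedView.degree tb)) c
    go : (_ ≡ y) ⊎ (_ ≡ z) → (_ ≡ y) ⊎ (_ ≡ z) → CD c x ≡ W (edgeOf G xa) c + W (edgeOf G xb) c + W ep c
    go (inj₁ refl) (inj₁ refl) = ⊥-elim (a≢b refl)
    go (inj₂ refl) (inj₂ refl) = ⊥-elim (a≢b refl)
    go (inj₁ refl) (inj₂ refl)
      rewrite edge-unique (edgeOf-joins G xa) (edgeOf-joins G adj-y) | edge-unique (edgeOf-joins G xb) (edgeOf-joins G adj-z) =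
      trans cd (trans (cong (W ey c +_) (cong (W ez c +_) (+-identityʳ _))) (sym (+-assoc (W ey c) _ _)))
    go (inj₂ refl) (inj₁ refl)
      rewrite edge-unique (edgeOf-joins G xa) (edgeOf-joins G adj-z) | edge-unique (edgeOf-joins G xb) (edgeOf-joins G adj-y) =
      trans cd (trans (cong (W ey c +_) (cong (W ez c +_) (+-identityʳ _)))
        (trans (sym (+-assoc (W ey c) _ _)) (cong (_+ W ep c) (+-comm (W ey c) (W ez c)))))

  branch-owner : ∀ {d br x p} → BranchStart d br x p → ∀ o k → L p ≡ pend o k → o ≡ toℕ x
  branch-owner {br = pendant} (j , e , _) o k e′ with trans (sym e) e′
  ... | refl = refl
  branch-owner {br = down} (inj₁ (m , e , _)) o k e′ = ⊥-elim (label-clash e e′ (λ ()))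
  branch-owner {br = down} (inj₂ e) o k e′ = ⊥-elim (label-clash e e′ (λ ()))
  branch-owner {br = up _} (_ , _ , inj₁ (r , e , _)) o k e′ = ⊥-elim (label-clash e e′ (λ ()))
  branch-owner {br = up _} (_ , _ , inj₂ (e , _)) o k e′ = ⊥-elim (label-clash e e′ (λ ()))

  PendantBranchOutcome : V G → EdgeIx G → Set
  PendantBranchOutcome X e = (Σ (EdgeIx G) λ f → (Ed f ≡ true) × OnPendantPath (toℕ X) f) ⊎ ((Ed e ≡ false) × CD (col e) X ≢ 2)

  pendant-branch : ∀ {X d} (tb : BranchedView X d pendant) → L X ≡ tri d pendant →
    PendantBranchOutcome X (edgeOf G (BranchedView.branch-adj tb))
  pendant-branch {X} tb lX with BranchedView.branch-start tb
  ... | zero , _ , ()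
  ... | suc j , e , odd with pendant-path-outcome (suc j) e (joins-sym G (edgeOf-joins G (BranchedView.branch-adj tb))) (λ q → label-clash lX q (λ ()))
  ...   | inj₁ doubled = inj₁ doubled
  ...   | inj₂ (e-undoubled , cd) = inj₂ (e-undoubled , λ h →
    irregular (edgeOf-joins G (BranchedView.branch-adj tb)) (trans h (sym (trans cd (forcedDeg-odd (suc j) odd)))))

  In3 : V G → V G → V G → V G → Set
  In3 x A B C = (x ≡ A) ⊎ (x ≡ B) ⊎ (x ≡ C)

  data LocalKind (A B C : V G) (f : EdgeIx G) : Set where
    kTri : ∀ {x w} → Joins G f x w → In3 x A B C → In3 w A B C → LocalKind A B C f
    kPend : ∀ {o} → OnPendantPath o f → (o ≡ toℕ B) ⊎ (o ≡ toℕ C) → LocalKind A B C f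
    kAp : ∀ {p} → Joins G f A p → CD (col f) A ≡ 4 → (∀ o k → L p ≡ pend o k → o ≡ toℕ A) → LocalKind A B C f

  LocalWitness : V G → V G → V G → Set
  LocalWitness A B C = Σ (EdgeIx G) λ f → (Ed f ≡ true) × LocalKind A B C f

  module _ {A B C d brA} (lA : L A ≡ tri d brA) (tbA : BranchedView A d brA) (lB : L B ≡ tri d pendant) (lC : L C ≡ tri d pendant)
    (aAB : Adj G A B) (aBC : Adj G B C) (aAC : Adj G A C) where

    tbB = triView lB
    tbC = triView lC
    eAB = edgeOf G aAB
    eBC = edgeOf G aBC
    eAC = edgeOf G aAC
    eAp = edgeOf G (BranchedView.branch-adj tbA)
    eBp = edgeOf G (BranchedView.branch-adj tbB)
    eCq = edgeOf G (BranchedView.branch-adj tbC)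

    edgeOf-sym : ∀ {x y} (a : Adj G x y) → edgeOf G (adj-sym a) ≡ edgeOf G a
    edgeOf-sym a = edge-unique (edgeOf-joins G (adj-sym a)) (joins-sym G (edgeOf-joins G a))

    colDeg-A : ∀ c → CD c A ≡ W eAB c + W eAC c + W eAp c
    colDeg-A = colDeg-branched tbA aAB aAC lB lC (adj⇒≢ aBC)

    colDeg-B : ∀ c → CD c B ≡ W eAB c + W eBC c + W eBp c
    colDeg-B c = trans (colDeg-branched tbB (adj-sym aAB) aBC lA lC (adj⇒≢ aAC) c) (cong (λ i → W i c + W eBC c + W eBp c) (edgeOf-sym aAB))

    colDeg-C : ∀ c → CD c C ≡ W eAC c + W eBC c + W eCq c
    colDeg-C c = trans (colDeg-branched tbC (adj-sym aAC) (adj-sym aBC) lA lB (adj⇒≢ aAB) c)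
      (cong₂ (λ i i′ → W i c + W i′ c + W eCq c) (edgeOf-sym aAC) (edgeOf-sym aBC))

    -- With the triangle and the two pendant branch edges undoubled, local irregularity leaves
    -- one colouring: all edges at A share a colour and A's branch edge is doubled.
    undoubled-triangle : Ed eAB ≡ false → Ed eBC ≡ false → Ed eAC ≡ false →
      Ed eBp ≡ false → CD (col eBp) B ≢ 2 → Ed eCq ≡ false → CD (col eCq) C ≢ 2 →
      (Ed eAp ≡ true) × (CD (col eAp) A ≡ 4)
    undoubled-triangle uAB uBC uAC uBp cdB uCq cdC =
      proj₁ forced , trans (cd-A (col eAp)) (proj₂ forced)
      where
      cd-A : ∀ c → CD c A ≡ matches (col eAB) c + matches (col eAC) c + W eAp c
      cd-A c = trans (colDeg-A c) (cong (_+ W eAp c) (cong₂ _+_ (undoubled c uAB) (undoubled c uAC)))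
      cd-B : ∀ c → CD c B ≡ matches (col eAB) c + matches (col eBC) c + matches (col eBp) c
      cd-B c = trans (colDeg-B c) (cong₂ _+_ (cong₂ _+_ (undoubled c uAB) (undoubled c uBC)) (undoubled c uBp))
      cd-C : ∀ c → CD c C ≡ matches (col eAC) c + matches (col eBC) c + matches (col eCq) c
      cd-C c = trans (colDeg-C c) (cong₂ _+_ (cong₂ _+_ (undoubled c uAC) (undoubled c uBC)) (undoubled c uCq))
      forced = triangle-colours (col eAB) (col eBC) (col eAC) (col eBp) (col eCq) (col eAp) (Ed eAp)
        (λ h → cdB (trans (cd-B (col eBp)) h))
        (λ h → cdC (trans (cd-C (col eCq)) h))
        (λ h → irregular (edgeOf-joins G aAB) (trans (cd-A (col eAB)) (trans h (sym (cd-B (col eAB))))))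
        (λ h → irregular (edgeOf-joins G aBC) (trans (cd-B (col eBC)) (trans h (sym (cd-C (col eBC))))))
        (λ h → irregular (edgeOf-joins G aAC) (trans (cd-A (col eAC)) (trans h (sym (cd-C (col eAC))))))

    local-witness : LocalWitness A B C
    local-witness with pendant-branch tbB lB | pendant-branch tbC lC | Ed eAB in dAB | Ed eBC in dBC | Ed eAC in dAC
    ... | inj₁ (f , df , po) | _ | _ | _ | _ = f , df , kPend po (inj₁ refl)
    ... | _ | inj₁ (f , df , po) | _ | _ | _ = f , df , kPend po (inj₂ refl)
    ... | _ | _ | true | _ | _ = eAB , dAB , kTri (edgeOf-joins G aAB) (inj₁ refl) (inj₂ (inj₁ refl))
    ... | _ | _ | _ | true | _ = eBC , dBC , kTri (edgeOf-joins G aBC) (inj₂ (inj₁ refl)) (inj₂ (inj₂ refl))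
    ... | _ | _ | _ | _ | true = eAC , dAC , kTri (edgeOf-joins G aAC) (inj₁ refl) (inj₂ (inj₂ refl))
    ... | inj₂ (uBp , cdB) | inj₂ (uCq , cdC) | false | false | false =
      eAp , proj₁ forced , kAp (edgeOf-joins G (BranchedView.branch-adj tbA)) (proj₂ forced) (branch-owner (BranchedView.branch-start tbA))
      where forced = undoubled-triangle dAB dBC dAC uBp cdB uCq cdC

-- Every pendant triangle without a vertex of degree two owns a doubled edge

module Witnesses (G : Graph) (ℓ : ℕ → Label) (nlL : LooplessEdges G) (lc : ∀ x → Invariant.Cond G ℓ x)
  (Ed col : EdgeIx G → Bool) (LI : LIColouring G Ed col) where
  open Invariant G ℓ
  open Structure G ℓ nlL lc
  open Triangles G ℓ nlL lc
  open Paths G ℓ nlL lc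
  open Colouring G ℓ nlL lc Ed col LI

  data WitnessKind (T : Tri G) (f : EdgeIx G) : Set where
    triangleEdge : ∀ {x w} → Joins G f x w → InTri G x T → InTri G w T → WitnessKind T f
    pendantPathEdge : ∀ {o} → OnPendantPath o f → (Σ (V G) λ b → InTri G b T × (toℕ b ≡ o)) → WitnessKind T f
    branchEdge : ∀ {A p} → Joins G f A p → InTri G A T → CD (col f) A ≡ 4 → (∀ o k → L p ≡ pend o k → o ≡ toℕ A) → WitnessKind T f

  pend-not-on-triangle : ∀ {v o k T} → L v ≡ pend o k → IsTriangle G T → InTri G v T → ⊥
  pend-not-on-triangle lv it iv with triangle-label it iv
  ... | _ , _ , e = label-clash lv e (λ ())

  pend-neighbour-owner : ∀ {v w o o′ k k′} → L v ≡ pend o k → L w ≡ pend o′ k′ → Adj G v w → o ≡ o′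
  pend-neighbour-owner {k = zero} lv lw a with PendEndView.only (pendEndView lv) a
  ... | refl = cong pendOwner (trans (sym (PendEndView.near-label (pendEndView lv))) lw)
  pend-neighbour-owner {k = suc k} lv lw a with pendView lv
  ... | v with PendView.only v a
  ...   | inj₁ refl = cong pendOwner (trans (sym (PendView.far-label v)) lw)
  ...   | inj₂ refl with PendView.near-label v
  ...     | inj₁ e = cong pendOwner (trans (sym e) lw)
  ...     | inj₂ (_ , e , _) = ⊥-elim (label-clash e lw (λ ()))

  witness-determines-triangle : ∀ {T T′ f} → IsTriangle G T → IsTriangle G T′ → WitnessKind T f → WitnessKind T′ f → T ≡ T′
  witness-determines-triangle t t′ (triangleEdge j x∈ w∈) (triangleEdge j′ x∈′ w∈′) with joins-same G j j′
  ... | inj₁ (refl , _) = triangle-unique t t′ x∈ x∈′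
  ... | inj₂ (refl , _) = triangle-unique t t′ x∈ w∈′
  witness-determines-triangle t t′ (triangleEdge j x∈ w∈) (pendantPathEdge (v , w , j′ , k , lv) _) with joins-same G j j′
  ... | inj₁ (refl , _) = ⊥-elim (pend-not-on-triangle lv t x∈)
  ... | inj₂ (_ , refl) = ⊥-elim (pend-not-on-triangle lv t w∈)
  witness-determines-triangle t t′ (triangleEdge j x∈ w∈) (branchEdge j′ A∈ _ _) with joins-same G j j′
  ... | inj₁ (refl , _) = triangle-unique t t′ x∈ A∈
  ... | inj₂ (_ , refl) = triangle-unique t t′ w∈ A∈
  witness-determines-triangle t t′ k@(pendantPathEdge _ _) k′@(triangleEdge _ _ _) = sym (witness-determines-triangle t′ t k′ k)
  witness-determines-triangle t t′ (pendantPathEdge (v , w , j , _ , lv) (b , b∈ , ob)) (pendantPathEdge (v′ , w′ , j′ , _ , lv′) (b′ , b∈′ , ob′))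
    with joins-same G j j′
  ... | inj₁ (refl , _) with trans (sym lv) lv′
  ...   | refl = triangle-unique t t′ b∈ (subst (λ q → InTri G q _) (toℕ-injective (trans ob′ (sym ob))) b∈′)
  witness-determines-triangle t t′ (pendantPathEdge (v , w , j , _ , lv) (b , b∈ , ob)) (pendantPathEdge (v′ , w′ , j′ , _ , lv′) (b′ , b∈′ , ob′))
    | inj₂ (refl , refl) with pend-neighbour-owner lv lv′ (joins⇒adj G j)
  ...   | refl = triangle-unique t t′ b∈ (subst (λ q → InTri G q _) (toℕ-injective (trans ob′ (sym ob))) b∈′)
  witness-determines-triangle t t′ (pendantPathEdge (v , w , j , k , lv) (b , b∈ , ob)) (branchEdge j′ A∈ _ owner) with joins-same G j j′
  ... | inj₁ (refl , _) = ⊥-elim (pend-not-on-triangle lv t′ A∈)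
  ... | inj₂ (refl , _) = triangle-unique t t′ b∈ (subst (λ q → InTri G q _) (sym (toℕ-injective (trans ob (owner _ k lv)))) A∈)
  witness-determines-triangle t t′ k@(branchEdge _ _ _ _) k′@(triangleEdge _ _ _) = sym (witness-determines-triangle t′ t k′ k)
  witness-determines-triangle t t′ k@(branchEdge _ _ _ _) k′@(pendantPathEdge _ _) = sym (witness-determines-triangle t′ t k′ k)
  witness-determines-triangle t t′ (branchEdge j A∈ cd _) (branchEdge j′ A∈′ cd′ _) with joins-same G j j′
  ... | inj₁ (refl , _) = triangle-unique t t′ A∈ A∈′
  ... | inj₂ (refl , refl) = ⊥-elim (irregular j (trans cd (sym cd′)))

  pendant-or-odd : ∀ {x d br} → L x ≡ tri d br → ¬ deg G x ≡ 2 → (br ≡ pendant) ⊎ OddBranch br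
  pendant-or-odd {br = none} e n = ⊥-elim (n (UnbranchedView.degree (triView e)))
  pendant-or-odd {br = pendant} e n = inj₁ refl
  pendant-or-odd {br = down} e n = inj₂ tt
  pendant-or-odd {br = up _} e n = inj₂ tt

  branchedView : ∀ {x d br} → L x ≡ tri d br → (br ≡ pendant) ⊎ OddBranch br → BranchedView x d br
  branchedView {br = none} e (inj₁ ())
  branchedView {br = none} e (inj₂ ())
  branchedView {br = pendant} e _ = triView e
  branchedView {br = down} e _ = triView e
  branchedView {br = up _} e _ = triView e

  toWitnessKind : ∀ {A B C T f} → InTri G A T → InTri G B T → InTri G C T → LocalKind A B C f → WitnessKind T f
  toWitnessKind {A} {B} {C} {T} iA iB iC k = go k
    where
    cv : ∀ {x} → In3 x A B C → InTri G x T
    cv (inj₁ refl) = iA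
    cv (inj₂ (inj₁ refl)) = iB
    cv (inj₂ (inj₂ refl)) = iC
    go : ∀ {f} → LocalKind A B C f → WitnessKind T f
    go (kTri en i1 i2) = triangleEdge en (cv i1) (cv i2)
    go (kPend po (inj₁ e)) = pendantPathEdge po (B , iB , sym e)
    go (kPend po (inj₂ e)) = pendantPathEdge po (C , iC , sym e)
    go (kAp en cd own) = branchEdge en iA cd own

  Witness : Tri G → Set
  Witness T = Σ (EdgeIx G) λ f → (Ed f ≡ true) × WitnessKind T f

  -- A pendant triangle has at most one odd branch, so two of its vertices carry pendant paths.
  witness : ∀ {T} → IsTriangle G T → Pendant G T → NoDeg2Vertex G T → Witness T
  witness {a , b , c} t@(a<b , b<c , ab , bc , ac) pendant-T (a≢2 , b≢2 , c≢2) with triangleAt ab ac bc (<⇒≢ᶠ {G} b<c)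
  ... | d , br-a , la , (br-b , lb , _) , (br-c , lc′ , _) =
    choose (pendant-or-odd la a≢2) (pendant-or-odd lb b≢2) (pendant-or-odd lc′ c≢2)
    where
    a∈ : InTri G a (a , b , c)
    a∈ = inj₁ refl
    b∈ : InTri G b (a , b , c)
    b∈ = inj₂ (inj₁ refl)
    c∈ : InTri G c (a , b , c)
    c∈ = inj₂ (inj₂ refl)
    from : ∀ {A B C} → InTri G A (a , b , c) → InTri G B (a , b , c) → InTri G C (a , b , c) → LocalWitness A B C → Witness (a , b , c)
    from A∈ B∈ C∈ (f , doubled , k) = f , doubled , toWitnessKind A∈ B∈ C∈ k
    choose : (br-a ≡ pendant) ⊎ OddBranch br-a → (br-b ≡ pendant) ⊎ OddBranch br-b → (br-c ≡ pendant) ⊎ OddBranch br-c → Witness (a , b , c)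
    choose (inj₂ oa) (inj₂ ob) _ = ⊥-elim (at-most-one-odd-branch t pendant-T a∈ b∈ (<⇒≢ᶠ {G} a<b) la lb oa ob)
    choose (inj₂ oa) _ (inj₂ oc) = ⊥-elim (at-most-one-odd-branch t pendant-T a∈ c∈ (<⇒≢ᶠ {G} (<-trans a<b b<c)) la lc′ oa oc)
    choose _ (inj₂ ob) (inj₂ oc) = ⊥-elim (at-most-one-odd-branch t pendant-T b∈ c∈ (<⇒≢ᶠ {G} b<c) lb lc′ ob oc)
    choose ka (inj₁ refl) (inj₁ refl) = from a∈ b∈ c∈ (local-witness la (branchedView la ka) lb lc′ ab bc ac)
    choose (inj₁ refl) kb (inj₁ refl) = from b∈ a∈ c∈ (local-witness lb (branchedView lb kb) la lc′ (adj-sym ab) ac bc)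
    choose (inj₁ refl) (inj₁ refl) kc = from c∈ a∈ b∈ (local-witness lc′ (branchedView lc′ kc) la lb (adj-sym ac) ab (adj-sym bc))

  data WitnessList : List (Tri G) → List (EdgeIx G) → Set where
    [] : WitnessList [] []
    _∷_ : ∀ {T f Ts fs} → (IsTriangle G T × (Ed f ≡ true) × WitnessKind T f) → WitnessList Ts fs → WitnessList (T ∷ Ts) (f ∷ fs)

  witnessList : ∀ Ps → All (λ T → IsTriangle G T × Pendant G T × NoDeg2Vertex G T) Ps → Σ (List (EdgeIx G)) (WitnessList Ps)
  witnessList [] [] = [] , []
  witnessList (T ∷ Ps) ((it , pd , nd) ∷ hs) with witness it pd nd | witnessList Ps hs
  ... | f , ef , k | fs , r = f ∷ fs , (it , ef , k) ∷ r

  witnessList-length : ∀ {Ps fs} → WitnessList Ps fs → length Ps ≡ length fs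
  witnessList-length [] = refl
  witnessList-length (_ ∷ r) = cong suc (witnessList-length r)

  witnessList-doubled : ∀ {Ps fs} → WitnessList Ps fs → All (λ f → Ed f ≡ true) fs
  witnessList-doubled [] = []
  witnessList-doubled ((_ , ef , _) ∷ r) = ef ∷ witnessList-doubled r

  witnessList-unique : ∀ {Ps fs} → WitnessList Ps fs → Unique Ps → Unique fs
  witnessList-unique [] _ = []
  witnessList-unique {T ∷ Ps} {f ∷ fs} ((it , ef , k) ∷ r) (n ∷ u) = go r n ∷ witnessList-unique r u
    where
    go : ∀ {Ps′ fs′} → WitnessList Ps′ fs′ → All (λ T′ → T ≢ T′) Ps′ → All (λ f′ → f ≢ f′) fs′
    go [] [] = []
    go ((it′ , _ , k′) ∷ r′) (m ∷ ms) = (λ { refl → m (witness-determines-triangle it it′ k k′) }) ∷ go r′ ms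

  pendants≤doubled : ∀ Ps → Unique Ps → All (λ T → IsTriangle G T × Pendant G T × NoDeg2Vertex G T) Ps →
    length Ps ≤ countTrue Ed
  pendants≤doubled Ps uP allP with witnessList Ps allP
  ... | fs , r = begin
    length Ps     ≡⟨ witnessList-length r ⟩
    length fs     ≤⟨ length≤countTrue Ed fs (witnessList-unique r uP) (witnessList-doubled r) ⟩
    countTrue Ed  ∎
    where open ≤-Reasoning

mainTheorem5 : (G : Graph) → InT G →
    (Σ (List (Tri G)) λ Ts → (Unique Ts × All (IsTriangle G) Ts × 3 ≤ length Ts)) →
    (Ps : List (Tri G)) → Unique Ps →
    All (λ T → IsTriangle G T × Pendant G T × NoDeg2Vertex G T) Ps →
    (Ed : EdgeIx G → Bool) → Admissible G Ed →
    length Ps ≤ countTrue Ed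
mainTheorem5 G t _ Ps unique pendants Ed (col , LI) with 𝔗-labelled t
... | nlL , ℓ , lc = Witnesses.pendants≤doubled G ℓ nlL lc Ed col LI Ps unique pendants
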